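{- Let $\mathcal T$ be the $I$-reduced PQ-tree of $G_j$ ($j\in\{1,2\}$). Then: (0) Let $l_1,l_2$ be two distinct leaves of $\mathcal T$ whose cliques both contain a vertex $t\in I$, and let $y$ be their least common ancestor. (a) If $y$ is a P-node, then all descendant cliques of $y$ contain $t$. (b) If $y$ is a Q-node, then $t$ is contained in all descendant cliques of all children of $y$ lying between (and including) the child of $y$ that is an ancestor of $l_1$ and the child of $y$ that is an ancestor of $l_2$ in the child order of $y$. (1) Each max-clique is represented by a unique node of $\mathcal T$. Moreover, for every non-leaf node $n$ of $\mathcal T$: (2) a vertex $u$ is in $U(n)$ if and only if $u\in U(n_1)$ for every child $n_1$ of $n$; (3) $n$ has a max-clique node as a descendant; (4) if $n$ is a P-node, then $U(n)=U(n_1)\cap U(n_2)$ for any two children $n_1,n_2$ of $n$; (5) if $n$ is a P-node, then every child of $n$ that is a subclique node represents the clique $U(n)$; (6) if $n$ is a Q-node with first child $n_1$ and last child $n_2$, then $U(n)=U(n_1)\cap U(n_2)$.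
   Context: $G_1,G_2$ are interval graphs with $I=V(G_1)\cap V(G_2)$ and $G_1[I]=G_2[I]$. Cliques may be empty. A PQ-tree is a rooted ordered tree with P-nodes and Q-nodes (nodes with two children regarded as Q-nodes); its leaf orders are obtained by arbitrarily permuting children of P-nodes and optionally reversing the children order of Q-nodes. The PQ-tree of an interval graph $G$ is the Booth–Lueker PQ-tree whose leaves are the maximal cliques of $G$ and whose leaf orders are exactly the orderings of the maximal cliques in which the cliques containing each vertex are consecutive. The $I$-restricted PQ-tree of $G_j$ replaces each leaf clique $Q$ of the PQ-tree of $G_j$ by $Q\cap I$. The $I$-reduced PQ-tree of $G_j$ is obtained from the $I$-restricted PQ-tree $T$ by: starting with $T'=T$; as long as some non-leaf node of $T'$ has all leaf descendants equal to a single clique $X$, replace it and its subtree by a single leaf $X$; as long as some Q-node has two consecutive children $n_a,n_b$ all of whose leaf descendants equal a single clique $X$, replace $n_a,n_b$ and their subtrees by a single leaf $X$. Each leaf of $\mathcal T$ corresponds to a clique of $G_j[I]$; a leaf is a max-clique node (its clique a max-clique) if its clique is a maximal clique of $G_j[I]$, and a subclique node otherwise. The descendant cliques of a node $n$ are the cliques of the leaf descendants of $n$; $U(n)$, the universal set of $n$, is the set of vertices lying in all descendant cliques of $n$ (so $U(l)=X$ for a leaf $l$ with clique $X$). -}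

module Defs where

open import Data.Nat using (ℕ; zero; suc; _≤_)
open import Data.Bool using (Bool; true; false)
open import Data.Fin using (Fin) renaming (_≤_ to _≤ᶠ_)
open import Data.Fin.Subset using (Subset; _∈_; _⊆_; _∩_; ⋂)
open import Data.Fin.Properties using () renaming (_≟_ to _≟ᶠ_)
open import Data.Vec.Properties using (≡-dec)
import Data.Bool.Properties as BoolP
open import Data.List using (List; []; _∷_; _++_; length; lookup; reverse)
open import Data.List.Relation.Unary.All using (All)
open import Data.List.Relation.Unary.Unique.Propositional using (Unique)
open import Data.List.Membership.Propositional using () renaming (_∈_ to _∈ˡ_)
open import Data.List.Relation.Binary.Permutation.Propositional using (_↭_)
open import Data.Maybe using (Maybe; just; nothing)
open import Data.Product using (Σ; _×_; _,_; ∃)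
open import Data.Unit using (⊤)
open import Relation.Binary.PropositionalEquality using (_≡_; _≢_)
open import Relation.Nullary using (¬_; yes; no)
open import Function.Bundles using (_⇔_)

record Graph (N : ℕ) : Set where
  field
    V      : Subset N
    E      : Fin N → Fin N → Bool
    E-sym  : ∀ u v → E u v ≡ E v u
    E-irr  : ∀ v → E v v ≡ false
    E-inV  : ∀ u v → E u v ≡ true → u ∈ V

open Graph public

Adj : ∀ {N} → Graph N → Fin N → Fin N → Set
Adj G u v = E G u v ≡ true

IsInterval : ∀ {N} → Graph N → Set
IsInterval {N} G =
  Σ (Fin N → ℕ) λ l → Σ (Fin N → ℕ) λ r →
    (∀ v → v ∈ V G → l v ≤ r v) ×
    (∀ u v → u ∈ V G → v ∈ V G → u ≢ v →
       (Adj G u v ⇔ (l u ≤ r v × l v ≤ r u)))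

-- Cliques of the graph with vertex set W and adjacency adj
-- (for G[I] take W = V G ∩ I and adj = Adj G, i.e. the induced subgraph).
IsClique : ∀ {N} → Subset N → (Fin N → Fin N → Set) → Subset N → Set
IsClique W adj X = X ⊆ W × (∀ u v → u ∈ X → v ∈ X → u ≢ v → adj u v)

IsMaxClique : ∀ {N} → Subset N → (Fin N → Fin N → Set) → Subset N → Set
IsMaxClique W adj X = IsClique W adj X × (∀ Y → IsClique W adj Y → X ⊆ Y → Y ⊆ X)

MaxCliqueOf : ∀ {N} → Graph N → Subset N → Set
MaxCliqueOf G = IsMaxClique (V G) (Adj G)

MaxCliqueOfInduced : ∀ {N} → Graph N → Subset N → Subset N → Set
MaxCliqueOfInduced G I = IsMaxClique (V G ∩ I) (Adj G)

SameOn : ∀ {N} → Graph N → Graph N → Subset N → Set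
SameOn G₁ G₂ I = ∀ u v → u ∈ I → v ∈ I → E G₁ u v ≡ E G₂ u v

data PQ (A : Set) : Set where
  leaf  : A → PQ A
  pnode : List (PQ A) → PQ A
  qnode : List (PQ A) → PQ A

children : ∀ {A} → PQ A → List (PQ A)
children (leaf _)   = []
children (pnode cs) = cs
children (qnode cs) = cs

mutual
  leaves : ∀ {A} → PQ A → List A
  leaves (leaf x)   = x ∷ []
  leaves (pnode cs) = leavesL cs
  leaves (qnode cs) = leavesL cs

  leavesL : ∀ {A} → List (PQ A) → List A
  leavesL []       = []
  leavesL (c ∷ cs) = leaves c ++ leavesL cs

-- properness: P-nodes have ≥ 3 children, Q-nodes ≥ 2 children
-- (a node with two children is regarded as a Q-node)
mutual
  Proper : ∀ {A} → PQ A → Set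
  Proper (leaf _)   = ⊤
  Proper (pnode cs) = 3 ≤ length cs × ProperL cs
  Proper (qnode cs) = 2 ≤ length cs × ProperL cs

  ProperL : ∀ {A} → List (PQ A) → Set
  ProperL []       = ⊤
  ProperL (c ∷ cs) = Proper c × ProperL cs

mutual
  data Frontier {A : Set} : PQ A → List A → Set where
    f-leaf : ∀ x → Frontier (leaf x) (x ∷ [])
    f-p    : ∀ {cs ds L} → cs ↭ ds → FrontierL ds L → Frontier (pnode cs) L
    f-q    : ∀ {cs L} → FrontierL cs L → Frontier (qnode cs) L
    f-qrev : ∀ {cs L} → FrontierL (reverse cs) L → Frontier (qnode cs) L

  data FrontierL {A : Set} : List (PQ A) → List A → Set where
    fl-[] : FrontierL [] []
    fl-∷  : ∀ {c cs L₁ L₂} → Frontier c L₁ → FrontierL cs L₂ → FrontierL (c ∷ cs) (L₁ ++ L₂)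

ConsecutiveOrdering : ∀ {N} → Graph N → List (Subset N) → Set
ConsecutiveOrdering {N} G L =
  Unique L ×
  (∀ X → (X ∈ˡ L ⇔ MaxCliqueOf G X)) ×
  (∀ (v : Fin N) (i j k : Fin (length L)) → i ≤ᶠ j → j ≤ᶠ k →
     v ∈ lookup L i → v ∈ lookup L k → v ∈ lookup L j)

-- T is the (Booth–Lueker) PQ-tree of G: a proper PQ-tree whose leaf orders
-- are exactly the consecutive orderings of the maximal cliques of G
-- (this determines T up to equivalence).
IsPQTreeOf : ∀ {N} → Graph N → PQ (Subset N) → Set
IsPQTreeOf G T = Proper T × (∀ L → Frontier T L ⇔ ConsecutiveOrdering G L)

mutual
  restrict : ∀ {N} → Subset N → PQ (Subset N) → PQ (Subset N)
  restrict I (leaf Q)   = leaf (Q ∩ I)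
  restrict I (pnode cs) = pnode (restrictL I cs)
  restrict I (qnode cs) = qnode (restrictL I cs)

  restrictL : ∀ {N} → Subset N → List (PQ (Subset N)) → List (PQ (Subset N))
  restrictL I []       = []
  restrictL I (c ∷ cs) = restrict I c ∷ restrictL I cs

allEq : ∀ {N} → List (Subset N) → Maybe (Subset N)
allEq []       = nothing
allEq (x ∷ xs) = go x xs
  where
  go : _ → List _ → Maybe _
  go x []       = just x
  go x (y ∷ ys) with ≡-dec BoolP._≟_ x y
  ... | yes _ = go x ys
  ... | no  _ = nothing

uniform : ∀ {N} → PQ (Subset N) → Maybe (Subset N)
uniform t = allEq (leaves t)

mutual
  phase1 : ∀ {N} → PQ (Subset N) → PQ (Subset N)
  phase1 (leaf x) = leaf x
  phase1 (pnode cs) with uniform (pnode cs)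
  ... | just X  = leaf X
  ... | nothing = pnode (phase1L cs)
  phase1 (qnode cs) with uniform (qnode cs)
  ... | just X  = leaf X
  ... | nothing = qnode (phase1L cs)

  phase1L : ∀ {N} → List (PQ (Subset N)) → List (PQ (Subset N))
  phase1L []       = []
  phase1L (c ∷ cs) = phase1 c ∷ phase1L cs

-- phase 2: in each Q-node, repeatedly replace two consecutive children
-- all of whose leaf descendants equal a single clique X by a leaf X
consMerge : ∀ {N} → PQ (Subset N) → List (PQ (Subset N)) → List (PQ (Subset N))
consMerge c [] = c ∷ []
consMerge c (d ∷ ds) with uniform c | uniform d
... | just X | just Y with ≡-dec BoolP._≟_ X Y
...   | yes _ = leaf X ∷ ds
...   | no  _ = c ∷ d ∷ ds
consMerge c (d ∷ ds) | _ | _ = c ∷ d ∷ ds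

mergeRuns : ∀ {N} → List (PQ (Subset N)) → List (PQ (Subset N))
mergeRuns []       = []
mergeRuns (c ∷ cs) = consMerge c (mergeRuns cs)

mutual
  phase2 : ∀ {N} → PQ (Subset N) → PQ (Subset N)
  phase2 (leaf x)   = leaf x
  phase2 (pnode cs) = pnode (phase2L cs)
  phase2 (qnode cs) = qnode (mergeRuns (phase2L cs))

  phase2L : ∀ {N} → List (PQ (Subset N)) → List (PQ (Subset N))
  phase2L []       = []
  phase2L (c ∷ cs) = phase2 c ∷ phase2L cs

IReduced : ∀ {N} → Subset N → PQ (Subset N) → PQ (Subset N)
IReduced I T = phase2 (phase1 (restrict I T))

-- Nodes as positions (paths of child indices from the root)

Path : Set
Path = List ℕ

_‼_ : ∀ {A : Set} → List A → ℕ → Maybe A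
[]       ‼ _     = nothing
(x ∷ xs) ‼ zero  = just x
(x ∷ xs) ‼ suc i = xs ‼ i

data _at_≔_ {A : Set} : PQ A → Path → PQ A → Set where
  here  : ∀ {t} → t at [] ≔ t
  there : ∀ {t c s p} (i : ℕ) → children t ‼ i ≡ just c → c at p ≔ s → t at (i ∷ p) ≔ s

U : ∀ {N} → PQ (Subset N) → Subset N
U t = ⋂ (leaves t)

-- Every leaf order of the I-reduced tree 𝒯 arises from a leaf order of the PQ-tree of G by
-- intersecting the cliques with I and collapsing adjacent equal cliques, and both steps keep the
-- cliques containing a fixed vertex t ∈ I consecutive. So if t lies in two leaves below different
-- children of y, it lies in every leaf that some leaf order of y puts between them: in all leaves of
-- y when y is a P-node, whose children may be permuted, and in the leaves of the children in between
-- when y is a Q-node; this is (0). The reduction also ensures that no internal node has all its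
-- leaves equal and that no two adjacent children of a Q-node carry a single equal clique. Together
-- with (0) this forbids a maximal clique of G[I] to occur twice (1), makes a largest leaf below a
-- node a maximal clique (3), and yields the descriptions (4)–(6) of the universal sets.

module Submission where

open import Defs
import Data.Bool.Properties as Bool
open import Data.Bool using (true)
open import Data.Empty using (⊥; ⊥-elim)
open import Data.Fin using (Fin; zero; suc) renaming (_≤_ to _≤ᶠ_)
import Data.Fin.Properties as Fin
open import Data.Fin.Subset using (Subset; _∈_; _∉_; _⊆_; _∩_; _∪_; ⁅_⁆; ⋂; ∣_∣)
open import Data.Fin.Subset.Properties
  using (x∈p∩q⁺; x∈p∩q⁻; ∈⊤; _∈?_; _⊆?_; ⊆-antisym; p⊂q⇒∣p∣<∣q∣; ∣p∣≤n;
         x∈p∪q⁻; x∈p∪q⁺; x∈⁅x⁆; x∈⁅y⁆⇒x≡y)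
open import Data.List using (List; []; _∷_; _++_; [_]; length; lookup; map; reverse)
open import Data.List.Membership.Propositional using (find; lose) renaming (_∈_ to _∈ˡ_)
open import Data.List.Membership.Propositional.Properties using (∈-++⁻; ∈-++⁺ˡ; ∈-++⁺ʳ; ∈-∃++; ∈-map⁺; ∈-map⁻)
open import Data.List.Properties
  using (++-assoc; ++-identityʳ; ++-monoid; map-++; reverse-++; reverse-involutive; reverse-map; unfold-reverse; ʳ++-defn)
open import Data.List.Relation.Binary.Permutation.Propositional using (_↭_; ↭-refl; ↭-sym; ↭-trans; ↭-reflexive; prep)
open import Data.List.Relation.Binary.Permutation.Propositional.Properties
  using (∈-resp-↭; ↭-reverse; ↭-map-inv; All-resp-↭; shift; ++-comm)
open import Data.List.Relation.Binary.Subset.Propositional using () renaming (_⊆_ to _⊆ˡ_)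
open import Data.List.Relation.Binary.Subset.Propositional.Properties using (⊆-refl; ⊆-trans; ++⁺)
open import Data.List.Relation.Unary.All as All using (All; []; _∷_)
import Data.List.Relation.Unary.All.Properties as All
open import Data.List.Relation.Unary.Any as Any using (Any; here; there)
import Data.List.Relation.Unary.Any.Properties as Any
open import Data.List.Relation.Unary.Linked using (Linked; []; [-]; _∷_)
open import Data.Maybe using (just; nothing)
open import Data.Nat using (ℕ; zero; suc; z≤n; s≤s; _+_; _≤_; _<_; _⊓_; _⊔_)
open import Data.Nat.Properties
  using (≤-trans; ≤-<-trans; <-≤-trans; <-irrefl; <-cmp; <⇒≤; n≤1+n; +-suc; +-monoˡ-≤; +-identityʳ; m≤n+m;
         m⊓n≤m; m⊓n≤n; m≤m⊔n; m≤n⊔m; m≤n⇒m⊓n≡m; m≤n⇒m⊔n≡n; m≥n⇒m⊓n≡n; m≥n⇒m⊔n≡m;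
         ≤-totalOrder)
  renaming (_≟_ to _≟ℕ_)
open import Data.List.Extrema ≤-totalOrder using (argmax; argmax-sel; f[⊥]≤f[argmax]; f[xs]≤f[argmax])
open import Data.Product using (Σ; ∃; ∃₂; _×_; _,_; proj₁; proj₂; swap)
open import Data.Sum using (_⊎_; inj₁; inj₂)
open import Data.Unit using (⊤; tt)
open import Data.Vec.Properties using (≡-dec)
open import Function.Bundles using (Equivalence; _⇔_; mk⇔)
open import Level using (Level)
open import Relation.Binary.Construct.Closure.ReflexiveTransitive using (Star; ε; _◅_; _◅◅_; gmap)
open import Relation.Binary.Definitions using (tri<; tri≈; tri>)
open import Relation.Binary.PropositionalEquality using (_≡_; _≢_; refl; sym; trans; cong; cong₂; subst; subst₂)
open import Relation.Nullary using (¬_; Dec; yes; no)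
open import Relation.Nullary.Decidable using (_×-dec_; _→-dec_; ¬?)
open import Relation.Unary using (Decidable)
open import Tactic.MonoidSolver using (solve)

-- A run of the three-state automaton below exists from `before` exactly when
-- the elements of the list satisfying P form one contiguous block.
data Phase : Set where
  before within after : Phase

data _≤ₚ_ : Phase → Phase → Set where
  before≤       : ∀ {p} → before ≤ₚ p
  within≤within : within ≤ₚ within
  within≤after  : within ≤ₚ after
  after≤after   : after ≤ₚ after

≤ₚ-refl : ∀ {p} → p ≤ₚ p
≤ₚ-refl {before} = before≤
≤ₚ-refl {within} = within≤within
≤ₚ-refl {after}  = after≤after

≤ₚ-trans : ∀ {p q r} → p ≤ₚ q → q ≤ₚ r → p ≤ₚ r
≤ₚ-trans before≤        _           = before≤
≤ₚ-trans within≤within  q≤r         = q≤r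
≤ₚ-trans within≤after   after≤after = within≤after
≤ₚ-trans after≤after    after≤after = after≤after

module _ {A : Set} (P : A → Set) where

  data Step : Phase → A → Phase → Set where
    skip  : ∀ {x} → ¬ P x → Step before x before
    enter : ∀ {x} → P x → Step before x within
    stay  : ∀ {x} → P x → Step within x within
    leave : ∀ {x} → ¬ P x → Step within x after
    rest  : ∀ {x} → ¬ P x → Step after x after

  data Run : Phase → List A → Phase → Set where
    halt : ∀ {s} → Run s [] s
    _▸_  : ∀ {s x s′ xs e} → Step s x s′ → Run s′ xs e → Run s (x ∷ xs) e

  Consecutive : List A → Set
  Consecutive L = ∃ (Run before L)

module _ {A : Set} {P : A → Set} where

  run-++⁻ : ∀ U {V s e} → Run P s (U ++ V) e → ∃ λ m → Run P s U m × Run P m V e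
  run-++⁻ []      r        = _ , halt , r
  run-++⁻ (x ∷ U) (st ▸ r) with run-++⁻ U r
  ... | m , r₁ , r₂ = m , st ▸ r₁ , r₂

  run-++⁺ : ∀ {U V s m e} → Run P s U m → Run P m V e → Run P s (U ++ V) e
  run-++⁺ halt     r₂ = r₂
  run-++⁺ (st ▸ r₁) r₂ = st ▸ run-++⁺ r₁ r₂

  step-mono : ∀ {s x s′} → Step P s x s′ → s ≤ₚ s′
  step-mono (skip _)  = before≤
  step-mono (enter _) = before≤
  step-mono (stay _)  = within≤within
  step-mono (leave _) = within≤after
  step-mono (rest _)  = after≤after

  run-mono : ∀ {s L e} → Run P s L e → s ≤ₚ e
  run-mono halt     = ≤ₚ-refl
  run-mono (st ▸ r) = ≤ₚ-trans (step-mono st) (run-mono r)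

  run-hit : ∀ {s L e} → Run P s L e → Any P L → s ≤ₚ within × within ≤ₚ e
  run-hit (skip ¬p  ▸ r) (here p)  = ⊥-elim (¬p p)
  run-hit (enter _  ▸ r) (here _)  = before≤ , run-mono r
  run-hit (stay _   ▸ r) (here _)  = within≤within , run-mono r
  run-hit (leave ¬p ▸ r) (here p)  = ⊥-elim (¬p p)
  run-hit (rest ¬p  ▸ r) (here p)  = ⊥-elim (¬p p)
  run-hit (st ▸ r)       (there a) with run-hit r a
  ... | s′≤w , w≤e = ≤ₚ-trans (step-mono st) s′≤w , w≤e

  run-within : ∀ {L} → Run P within L within → All P L
  run-within halt           = []
  run-within (stay p  ▸ r)  = p ∷ run-within r
  run-within (leave _ ▸ r)  with run-mono r
  ... | ()

  consecutive-between : ∀ A B {C} → Consecutive P (A ++ B ++ C) → Any P A → Any P C → All P B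
  consecutive-between A B (_ , r) pA pC with run-++⁻ A r
  ... | m₁ , r₁ , r′ with run-++⁻ B r′
  ... | m₂ , r₂ , r₃ = squeeze (proj₂ (run-hit r₁ pA)) (run-mono r₂) (proj₁ (run-hit r₃ pC)) r₂
    where
    squeeze : ∀ {a b} → within ≤ₚ a → a ≤ₚ b → b ≤ₚ within → Run P a B b → All P B
    squeeze within≤within within≤within within≤within r = run-within r

  step-idem : ∀ {s x s′ s″} → Step P s x s′ → Step P s′ x s″ → s″ ≡ s′
  step-idem (skip _)   (skip _)   = refl
  step-idem (skip ¬p)  (enter p)  = ⊥-elim (¬p p)
  step-idem (enter _)  (stay _)   = refl
  step-idem (enter p)  (leave ¬p) = ⊥-elim (¬p p)
  step-idem (stay _)   (stay _)   = refl
  step-idem (stay p)   (leave ¬p) = ⊥-elim (¬p p)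
  step-idem (leave _)  (rest _)   = refl
  step-idem (rest _)   (rest _)   = refl

  run-absorb : ∀ {s x} F {L e} → All (_≡ x) F → Run P s (x ∷ F ++ L) e → Run P s (x ∷ L) e
  run-absorb []      []           r = r
  run-absorb (_ ∷ F) (refl ∷ F≡x) (st ▸ (st′ ▸ r)) with step-idem st st′
  ... | refl = run-absorb F F≡x (st ▸ r)

run-map : ∀ {A B : Set} {P : A → Set} {Q : B → Set} (f : A → B) →
  (∀ {x} → P x → Q (f x)) → (∀ {x} → Q (f x) → P x) →
  ∀ {s L e} → Run P s L e → Run Q s (map f L) e
run-map f to from halt       = halt
run-map f to from (st ▸ r)   = map-step st ▸ run-map f to from r
  where
  map-step : ∀ {s x s′} → Step _ s x s′ → Step _ s (f x) s′
  map-step (skip ¬p)  = skip (λ q → ¬p (from q))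
  map-step (enter p)  = enter (to p)
  map-step (stay p)   = stay (to p)
  map-step (leave ¬p) = leave (λ q → ¬p (from q))
  map-step (rest ¬p)  = rest (λ q → ¬p (from q))

module _ {A : Set} {P : A → Set} (P? : Decidable P) where

  LookupConvex : List A → Set
  LookupConvex L = ∀ (i j k : Fin (length L)) → i ≤ᶠ j → j ≤ᶠ k →
    P (lookup L i) → P (lookup L k) → P (lookup L j)

  private
    convex-tail : ∀ {x L} → LookupConvex (x ∷ L) → LookupConvex L
    convex-tail c i j k i≤j j≤k = c (suc i) (suc j) (suc k) (s≤s i≤j) (s≤s j≤k)

    convex-drop₂ : ∀ {x y L} → LookupConvex (x ∷ y ∷ L) → LookupConvex (x ∷ L)
    convex-drop₂ {x} {y} {L} c i j k i≤j j≤k pi pk =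
      back j (c (skip₁ i) (skip₁ j) (skip₁ k) (skip₁-mono i≤j) (skip₁-mono j≤k) (forth i pi) (forth k pk))
      where
      skip₁ : Fin (suc (length L)) → Fin (suc (suc (length L)))
      skip₁ zero    = zero
      skip₁ (suc i) = suc (suc i)
      skip₁-mono : ∀ {a b} → a ≤ᶠ b → skip₁ a ≤ᶠ skip₁ b
      skip₁-mono {zero}  _         = z≤n
      skip₁-mono {suc a} {suc b} (s≤s h) = s≤s (s≤s h)
      forth : ∀ a → P (lookup (x ∷ L) a) → P (lookup (x ∷ y ∷ L) (skip₁ a))
      forth zero    p = p
      forth (suc a) p = p
      back : ∀ a → P (lookup (x ∷ y ∷ L) (skip₁ a)) → P (lookup (x ∷ L) a)
      back zero    p = p
      back (suc a) p = p

    run-after : ∀ L → (∀ m → ¬ P (lookup L m)) → Run P after L after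
    run-after []      _  = halt
    run-after (x ∷ L) ¬P = rest (¬P zero) ▸ run-after L (λ m → ¬P (suc m))

    run-within-from : ∀ x → P x → ∀ L → LookupConvex (x ∷ L) → ∃ (Run P within L)
    run-within-from x px []      c = _ , halt
    run-within-from x px (y ∷ L) c with P? y
    ... | yes py = let e , r = run-within-from x px L (convex-drop₂ c) in e , stay py ▸ r
    ... | no ¬py = after , leave ¬py ▸ run-after L
                     (λ m pm → ¬py (c zero (suc zero) (suc (suc m)) z≤n (s≤s z≤n) px pm))

  lookupConvex⇒consecutive : ∀ L → LookupConvex L → Consecutive P L
  lookupConvex⇒consecutive []      c = _ , halt
  lookupConvex⇒consecutive (x ∷ L) c with P? x
  ... | no ¬p = let e , r = lookupConvex⇒consecutive L (convex-tail c) in e , skip ¬p ▸ r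
  ... | yes p = let e , r = run-within-from x p L c in e , enter p ▸ r

module _ {A : Set} where

  ‼-split : ∀ (xs : List A) j {y} → xs ‼ j ≡ just y → ∃₂ λ pre post → xs ≡ pre ++ y ∷ post × length pre ≡ j
  ‼-split (x ∷ xs) zero    refl = [] , xs , refl , refl
  ‼-split (x ∷ xs) (suc j) e    =
    let pre , post , eq , len = ‼-split xs j e in x ∷ pre , post , cong (x ∷_) eq , cong suc len

  ‼-split₂ : ∀ (xs : List A) {i j x y} → i < j → xs ‼ i ≡ just x → xs ‼ j ≡ just y →
    ∃₂ λ pre mid → ∃ λ post → xs ≡ pre ++ x ∷ mid ++ y ∷ post × length pre ≡ i × j ≡ suc (length pre + length mid)
  ‼-split₂ (_ ∷ xs) {zero}  {suc j} _       refl e₂ =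
    let mid , post , eq , len = ‼-split xs j e₂ in [] , mid , post , cong (_ ∷_) eq , refl , cong suc (sym len)
  ‼-split₂ (z ∷ xs) {suc i} {suc j} (s≤s i<j) e₁ e₂ =
    let pre , mid , post , eq , len , j≡ = ‼-split₂ xs i<j e₁ e₂ in
    z ∷ pre , mid , post , cong (z ∷_) eq , cong suc len , cong suc j≡

  ‼-between : ∀ (pre : List A) {x mid y post k z} → (pre ++ x ∷ mid ++ y ∷ post) ‼ k ≡ just z →
    length pre ≤ k → k ≤ suc (length pre + length mid) → z ≡ x ⊎ z ∈ˡ mid ⊎ z ≡ y
  ‼-between []      {k = zero}  refl _ _ = inj₁ refl
  ‼-between []      {mid = mid} {k = suc k} e _ (s≤s k≤) = inj₂ (in-middle mid e k≤)
    where
    in-middle : ∀ mid {y post k z} → (mid ++ y ∷ post) ‼ k ≡ just z → k ≤ length mid → z ∈ˡ mid ⊎ z ≡ y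
    in-middle []        {k = zero}  refl _ = inj₂ refl
    in-middle (m ∷ mid) {k = zero}  refl _ = inj₁ (here refl)
    in-middle (m ∷ mid) {k = suc k} e (s≤s k≤) with in-middle mid e k≤
    ... | inj₁ z∈mid = inj₁ (there z∈mid)
    ... | inj₂ z≡y   = inj₂ z≡y
  ‼-between (_ ∷ pre) {k = zero}  _ () _
  ‼-between (_ ∷ pre) {k = suc k} e (s≤s pre≤k) (s≤s k≤) = ‼-between pre e pre≤k k≤

  ‼-bound : ∀ (xs : List A) k {x} → xs ‼ k ≡ just x → k < length xs
  ‼-bound (_ ∷ xs) zero    _ = s≤s z≤n
  ‼-bound (_ ∷ xs) (suc k) e = s≤s (‼-bound xs k e)

  ‼-total : ∀ (xs : List A) k → k < length xs → ∃ λ x → xs ‼ k ≡ just x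
  ‼-total (x ∷ xs) zero    _         = x , refl
  ‼-total (_ ∷ xs) (suc k) (s≤s k<) = ‼-total xs k k<

  ‼-adjacent : ∀ (xs : List A) {i j x y} → i ≢ j → xs ‼ i ≡ just x → xs ‼ j ≡ just y →
    ∃ λ k → i ⊓ j ≤ k × suc k ≤ i ⊔ j × ∃₂ λ u v → xs ‼ k ≡ just u × xs ‼ suc k ≡ just v
  ‼-adjacent xs {i} {j} i≢j e₁ e₂ with <-cmp i j
  ... | tri≈ _ i≡j _ = ⊥-elim (i≢j i≡j)
  ... | tri< i<j _ _ =
    let v , e = ‼-total xs (suc i) (≤-<-trans i<j (‼-bound xs j e₂)) in
    i , m⊓n≤m i j , ≤-trans i<j (m≤n⊔m i j) , _ , v , e₁ , e
  ... | tri> _ _ j<i =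
    let v , e = ‼-total xs (suc j) (≤-<-trans j<i (‼-bound xs i e₁)) in
    j , m⊓n≤n i j , ≤-trans j<i (m≤m⊔n i j) , _ , v , e₂ , e

  Linked-‼ : ∀ {R : A → A → Set} {xs : List A} k {x y} → Linked R xs → xs ‼ k ≡ just x → xs ‼ suc k ≡ just y → R x y
  Linked-‼ zero    (r ∷ _)  refl refl = r
  Linked-‼ (suc k) (_ ∷ rs) e₁   e₂   = Linked-‼ k rs e₁ e₂
  Linked-‼ zero    [-]      refl ()
  Linked-‼ (suc k) [-]      ()

  ‼-last : ∀ (xs : List A) y → (xs ++ y ∷ []) ‼ length xs ≡ just y
  ‼-last []       y = refl
  ‼-last (_ ∷ xs) y = ‼-last xs y

  ‼-≤-last : ∀ (xs : List A) {y k z} → (xs ++ y ∷ []) ‼ k ≡ just z → k ≤ length xs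
  ‼-≤-last []       {k = zero}  _ = z≤n
  ‼-≤-last (_ ∷ xs) {k = zero}  _ = z≤n
  ‼-≤-last (_ ∷ xs) {k = suc k} e = s≤s (‼-≤-last xs e)

data Compare (p q : Path) : Set where
  equal : p ≡ q → Compare p q
  below : ∀ i r → q ≡ p ++ i ∷ r → Compare p q
  above : ∀ i r → p ≡ q ++ i ∷ r → Compare p q
  fork  : ∀ r i j rᵢ rⱼ → i ≢ j → p ≡ r ++ i ∷ rᵢ → q ≡ r ++ j ∷ rⱼ → Compare p q

compare : ∀ p q → Compare p q
compare []      []      = equal refl
compare []      (j ∷ q) = below j q refl
compare (i ∷ p) []      = above i p refl
compare (i ∷ p) (j ∷ q) with i ≟ℕ j
... | no i≢j  = fork [] i j p q i≢j refl refl
... | yes refl with compare p q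
...   | equal e                   = equal (cong (i ∷_) e)
...   | below k r e               = below k r (cong (i ∷_) e)
...   | above k r e               = above k r (cong (i ∷_) e)
...   | fork r k l rₖ rₗ k≢l e₁ e₂ = fork (i ∷ r) k l rₖ rₗ k≢l (cong (i ∷_) e₁) (cong (i ∷_) e₂)

-- Leaf orders and positions in PQ-trees

module _ {A : Set} where

  private variable
    s c y z n a b : PQ A
    cs xs ys : List (PQ A)
    L L₁ L₂ : List A
    x : A
    i : ℕ
    p q r : Path

  mutual
    frontier : (s : PQ A) → ∃ (Frontier s)
    frontier (leaf x)   = _ , f-leaf x
    frontier (pnode cs) = let _ , f = frontierL cs in _ , f-p ↭-refl f
    frontier (qnode cs) = let _ , f = frontierL cs in _ , f-q f

    frontierL : (cs : List (PQ A)) → ∃ (FrontierL cs)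
    frontierL []       = _ , fl-[]
    frontierL (c ∷ cs) = let _ , f = frontier c ; _ , fs = frontierL cs in _ , fl-∷ f fs

  frontierL-++ : FrontierL xs L₁ → FrontierL ys L₂ → FrontierL (xs ++ ys) (L₁ ++ L₂)
  frontierL-++ fl-[] g = g
  frontierL-++ (fl-∷ {L₁ = L} {L₂ = L′} f fs) g =
    subst (FrontierL _) (sym (++-assoc L L′ _)) (fl-∷ f (frontierL-++ fs g))

  frontierL-++⁻ : (xs : List (PQ A)) {ys : List (PQ A)} {L : List A} → FrontierL (xs ++ ys) L →
    ∃₂ λ L₁ L₂ → L ≡ L₁ ++ L₂ × FrontierL xs L₁ × FrontierL ys L₂
  frontierL-++⁻ []       f = [] , _ , refl , fl-[] , f
  frontierL-++⁻ (x ∷ xs) (fl-∷ {L₁ = L} f fs) with frontierL-++⁻ xs fs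
  ... | L₁ , L₂ , refl , g₁ , g₂ = L ++ L₁ , L₂ , sym (++-assoc L L₁ L₂) , fl-∷ f g₁ , g₂

  mutual
    frontier-reverse : Frontier s L → Frontier s (reverse L)
    frontier-reverse (f-leaf x) = f-leaf x
    frontier-reverse (f-p {ds = ds} π fl) = f-p (↭-trans π (↭-sym (↭-reverse ds))) (frontierL-reverse fl)
    frontier-reverse (f-q fl) = f-qrev (frontierL-reverse fl)
    frontier-reverse (f-qrev {cs = cs} fl) =
      f-q (subst (λ ds → FrontierL ds _) (reverse-involutive cs) (frontierL-reverse fl))

    frontierL-reverse : FrontierL cs L → FrontierL (reverse cs) (reverse L)
    frontierL-reverse fl-[] = fl-[]
    frontierL-reverse (fl-∷ {c = c} {cs = cs} {L₁ = L₁} {L₂ = L₂} f fs) =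
      subst₂ FrontierL (sym (unfold-reverse c cs))
        (trans (cong (reverse L₂ ++_) (++-identityʳ (reverse L₁))) (sym (reverse-++ L₁ L₂)))
        (frontierL-++ (frontierL-reverse fs) (fl-∷ (frontier-reverse f) fl-[]))

  ∈-leavesL⁻ : ∀ (cs : List (PQ A)) → x ∈ˡ leavesL cs → ∃ λ c → c ∈ˡ cs × x ∈ˡ leaves c
  ∈-leavesL⁻ (c ∷ cs) m with ∈-++⁻ (leaves c) m
  ... | inj₁ m₁ = c , here refl , m₁
  ... | inj₂ m₂ = let d , d∈ , m′ = ∈-leavesL⁻ cs m₂ in d , there d∈ , m′

  ∈-leavesL⁺ : ∀ (cs : List (PQ A)) → c ∈ˡ cs → x ∈ˡ leaves c → x ∈ˡ leavesL cs
  ∈-leavesL⁺ (c ∷ cs) (here refl) m = ∈-++⁺ˡ m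
  ∈-leavesL⁺ (d ∷ cs) (there c∈) m = ∈-++⁺ʳ (leaves d) (∈-leavesL⁺ cs c∈ m)

  mutual
    frontier-∈⁻ : Frontier s L → x ∈ˡ L → x ∈ˡ leaves s
    frontier-∈⁻ (f-leaf x) m = m
    frontier-∈⁻ (f-p {cs = cs} π fl) m =
      let c , c∈ , m′ = frontierL-∈⁻ fl m in ∈-leavesL⁺ cs (∈-resp-↭ (↭-sym π) c∈) m′
    frontier-∈⁻ (f-q {cs = cs} fl) m =
      let c , c∈ , m′ = frontierL-∈⁻ fl m in ∈-leavesL⁺ cs c∈ m′
    frontier-∈⁻ (f-qrev {cs = cs} fl) m =
      let c , c∈ , m′ = frontierL-∈⁻ fl m in ∈-leavesL⁺ cs (∈-resp-↭ (↭-reverse cs) c∈) m′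

    frontierL-∈⁻ : FrontierL cs L → x ∈ˡ L → ∃ λ c → c ∈ˡ cs × x ∈ˡ leaves c
    frontierL-∈⁻ (fl-∷ {L₁ = L₁} f fs) m with ∈-++⁻ L₁ m
    ... | inj₁ m₁ = _ , here refl , frontier-∈⁻ f m₁
    ... | inj₂ m₂ = let c , c∈ , m′ = frontierL-∈⁻ fs m₂ in c , there c∈ , m′

  mutual
    frontier-∈⁺ : Frontier s L → x ∈ˡ leaves s → x ∈ˡ L
    frontier-∈⁺ (f-leaf x) m = m
    frontier-∈⁺ (f-p {cs = cs} π fl) m =
      let c , c∈ , m′ = ∈-leavesL⁻ cs m in frontierL-∈⁺ fl (∈-resp-↭ π c∈) m′
    frontier-∈⁺ (f-q {cs = cs} fl) m =
      let c , c∈ , m′ = ∈-leavesL⁻ cs m in frontierL-∈⁺ fl c∈ m′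
    frontier-∈⁺ (f-qrev {cs = cs} fl) m =
      let c , c∈ , m′ = ∈-leavesL⁻ cs m in frontierL-∈⁺ fl (∈-resp-↭ (↭-sym (↭-reverse cs)) c∈) m′

    frontierL-∈⁺ : FrontierL cs L → c ∈ˡ cs → x ∈ˡ leaves c → x ∈ˡ L
    frontierL-∈⁺ (fl-∷ f fs) (here refl) m = ∈-++⁺ˡ (frontier-∈⁺ f m)
    frontierL-∈⁺ (fl-∷ {L₁ = L₁} f fs) (there c∈) m = ∈-++⁺ʳ L₁ (frontierL-∈⁺ fs c∈ m)

  ‼⇒∈ : ∀ {xs : List (PQ A)} {i c} → xs ‼ i ≡ just c → c ∈ˡ xs
  ‼⇒∈ {_ ∷ _} {zero}  refl = here refl
  ‼⇒∈ {_ ∷ _} {suc i} e    = there (‼⇒∈ e)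

  ∈⇒‼ : ∀ (xs : List (PQ A)) → c ∈ˡ xs → ∃ λ i → xs ‼ i ≡ just c
  ∈⇒‼ (_ ∷ xs) (here refl) = zero , refl
  ∈⇒‼ (_ ∷ xs) (there m)   = let i , e = ∈⇒‼ xs m in suc i , e

  ∈-leaves-child : children s ‼ i ≡ just c → x ∈ˡ leaves c → x ∈ˡ leaves s
  ∈-leaves-child {leaf _}   ()
  ∈-leaves-child {pnode cs} e m = ∈-leavesL⁺ cs (‼⇒∈ e) m
  ∈-leaves-child {qnode cs} e m = ∈-leavesL⁺ cs (‼⇒∈ e) m

  ∈-leaves-at : s at p ≔ n → x ∈ˡ leaves n → x ∈ˡ leaves s
  ∈-leaves-at here           m = m
  ∈-leaves-at {s = s} (there i e at) m = ∈-leaves-child {s = s} e (∈-leaves-at at m)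

  at-functional : s at p ≔ a → s at p ≔ b → a ≡ b
  at-functional here here = refl
  at-functional (there i e at) (there .i e′ at′) with trans (sym e) e′
  ... | refl = at-functional at at′

  at-++⁻ : ∀ q → s at (q ++ r) ≔ z → ∃ λ y → s at q ≔ y × y at r ≔ z
  at-++⁻ []      at              = _ , here , at
  at-++⁻ (i ∷ q) (there .i e at) = let y , at₁ , at₂ = at-++⁻ q at in y , there i e at₁ , at₂

  at-++⁺ : s at q ≔ y → y at r ≔ z → s at (q ++ r) ≔ z
  at-++⁺ here           at₂ = at₂
  at-++⁺ (there i e at₁) at₂ = there i e (at-++⁺ at₁ at₂)

  at-++-∷⁻ : ∀ q → s at (q ++ i ∷ r) ≔ z → s at q ≔ y → ∃ λ c → children y ‼ i ≡ just c × c at r ≔ z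
  at-++-∷⁻ q at at-y with at-++⁻ q at
  ... | y′ , at-y′ , there _ e at′ with at-functional at-y′ at-y
  ... | refl = _ , e , at′

  at-child : s at p ≔ n → children n ‼ i ≡ just c → s at (p ++ i ∷ []) ≔ c
  at-child at e = at-++⁺ at (there _ e here)

  leaf-at-∷ : ¬ (leaf x at (i ∷ r) ≔ z)
  leaf-at-∷ (there _ () _)

  mutual
    ∈-leaves⇒at : ∀ (s : PQ A) → x ∈ˡ leaves s → ∃ λ r → s at r ≔ leaf x
    ∈-leaves⇒at (leaf x)   (here refl) = [] , here
    ∈-leaves⇒at (pnode cs) m = let i , c , e , r , at = ∈-leavesL⇒at cs m in i ∷ r , there i e at
    ∈-leaves⇒at (qnode cs) m = let i , c , e , r , at = ∈-leavesL⇒at cs m in i ∷ r , there i e at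

    ∈-leavesL⇒at : ∀ (cs : List (PQ A)) → x ∈ˡ leavesL cs →
      ∃₂ λ i c → cs ‼ i ≡ just c × ∃ λ r → c at r ≔ leaf x
    ∈-leavesL⇒at (d ∷ ds) m with ∈-++⁻ (leaves d) m
    ... | inj₁ m₁ = let r , at = ∈-leaves⇒at d m₁ in zero , d , refl , r , at
    ... | inj₂ m₂ = let i , c , e , r , at = ∈-leavesL⇒at ds m₂ in suc i , c , e , r , at

  Embeds : PQ A → List A → Set
  Embeds s L = ∃₂ λ pre post → Frontier s (pre ++ L ++ post)

  private
    frontierL-child : ∀ {cs : List (PQ A)} {i c L} → cs ‼ i ≡ just c → Frontier c L →
      ∃₂ λ pre post → FrontierL cs (pre ++ L ++ post)
    frontierL-child {c ∷ cs} {zero} refl f = let post , fs = frontierL cs in [] , post , fl-∷ f fs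
    frontierL-child {d ∷ cs} {suc i} {L = L} e f with frontierL-child {cs} e f | frontier d
    ... | pre , post , fl | L₀ , f₀ =
      L₀ ++ pre , post , subst (FrontierL _) (sym (++-assoc L₀ pre _)) (fl-∷ f₀ fl)

    frontier-child : children s ‼ i ≡ just c → Frontier c L → Embeds s L
    frontier-child {leaf _}   () f
    frontier-child {pnode cs} e f = let pre , post , fl = frontierL-child e f in pre , post , f-p ↭-refl fl
    frontier-child {qnode cs} e f = let pre , post , fl = frontierL-child e f in pre , post , f-q fl

  frontier-at : s at q ≔ y → Frontier y L → Embeds s L
  frontier-at here f = [] , [] , subst (Frontier _) (sym (++-identityʳ _)) f
  frontier-at {L = L} (there i e at) f with frontier-at at f
  ... | pre , post , fc with frontier-child e fc
  ... | pre′ , post′ , fs = pre′ ++ pre , post ++ post′ , subst (Frontier _) reassoc fs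
    where
    reassoc : pre′ ++ (pre ++ L ++ post) ++ post′ ≡ (pre′ ++ pre) ++ L ++ post ++ post′
    reassoc = solve (++-monoid A)

  data Every (Pr : PQ A → Set) : PQ A → Set where
    every : Pr s → All (Every Pr) (children s) → Every Pr s

  All-‼ : ∀ {Q : PQ A → Set} {cs i c} → All Q cs → cs ‼ i ≡ just c → Q c
  All-‼ {i = zero}  (q ∷ qs) refl = q
  All-‼ {i = suc i} (q ∷ qs) e    = All-‼ qs e

  every-at : ∀ {Pr} → Every Pr s → s at p ≔ n → Pr n
  every-at (every pr _)  here           = pr
  every-at (every _ all) (there i e at) = every-at (All-‼ all e) at

  reverse-middle : ∀ (U : List A) x V → reverse (U ++ x ∷ V) ≡ reverse V ++ x ∷ reverse U
  reverse-middle U x V =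
    trans (reverse-++ U (x ∷ V)) (trans (cong (_++ reverse U) (ʳ++-defn V)) (++-assoc (reverse V) [ x ] (reverse U)))

  all-leaves-after : ∀ {P : A → Set} →
    (∀ {L} → Frontier s L → ∀ U V → L ≡ U ++ x ∷ V → All P V) → x ∈ˡ leaves s → P x → All P (leaves s)
  all-leaves-after {s = s} {x = x} {P = P} right x∈ Px with frontier s
  ... | L , f with ∈-∃++ (frontier-∈⁺ f x∈)
  ... | U , V , eq = All.tabulate (λ y∈ → which (∈-++⁻ U (subst (_ ∈ˡ_) eq (frontier-∈⁺ f y∈))))
    where
    which : ∀ {y} → y ∈ˡ U ⊎ y ∈ˡ x ∷ V → P y
    which (inj₁ y∈U) = All.lookup (right (frontier-reverse f) (reverse V) (reverse U)
                         (trans (cong reverse eq) (reverse-middle U x V))) (Any.reverse⁺ y∈U)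
    which (inj₂ (here refl))  = Px
    which (inj₂ (there y∈V)) = All.lookup (right f U V eq) y∈V

  all-leaves-before : ∀ {P : A → Set} →
    (∀ {L} → Frontier s L → ∀ U V → L ≡ U ++ x ∷ V → All P U) → x ∈ˡ leaves s → P x → All P (leaves s)
  all-leaves-before {x = x} left = all-leaves-after λ f U V eq →
    All.tabulate λ y∈V → All.lookup (left (frontier-reverse f) (reverse V) (reverse U)
                           (trans (cong reverse eq) (reverse-middle U x V))) (Any.reverse⁺ y∈V)

-- The reduction steps preserve consecutiveness

_≋_ : ∀ {A : Set} → List A → List A → Set
xs ≋ ys = xs ⊆ˡ ys × ys ⊆ˡ xs

≋-trans : ∀ {A : Set} {xs ys zs : List A} → xs ≋ ys → ys ≋ zs → xs ≋ zs
≋-trans (f , g) (f′ , g′) = ⊆-trans f f′ , ⊆-trans g′ g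

≋-++ : ∀ {A : Set} {ws xs ys zs : List A} → ws ≋ xs → ys ≋ zs → (ws ++ ys) ≋ (xs ++ zs)
≋-++ (f , g) (f′ , g′) = ++⁺ f f′ , ++⁺ g g′

module _ {N : ℕ} where

  private
    S : Set
    S = Subset N
    T : Set
    T = PQ S

  private variable
    s t c d : T
    cs ds es : List T
    L L′ L₁ L₂ : List S
    X Y : S

  record Uniform (s : T) (X : S) : Set where
    constructor uniformly
    field
      ∈-leaves : X ∈ˡ leaves s
      leaves-≡ : ∀ {y} → y ∈ˡ leaves s → y ≡ X

  private
    allEq∷-just : ∀ x (xs : List S) → allEq (x ∷ xs) ≡ just X → X ∈ˡ x ∷ xs × (∀ {y} → y ∈ˡ x ∷ xs → y ≡ X)
    allEq∷-just x []       refl = here refl , λ { (here refl) → refl }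
    allEq∷-just x (z ∷ zs) e with ≡-dec Bool._≟_ x z
    ... | yes refl = let m , h = allEq∷-just x zs e in
                     there m , λ { (here refl) → h (here refl) ; (there m′) → h m′ }

    allEq∷-nothing : ∀ x (xs : List S) → allEq (x ∷ xs) ≡ nothing → x ≡ X → ¬ (∀ {y} → y ∈ˡ xs → y ≡ X)
    allEq∷-nothing x (z ∷ zs) e x≡X h with ≡-dec Bool._≟_ x z
    ... | yes refl = allEq∷-nothing x zs e x≡X (λ m → h (there m))
    ... | no x≢z   = x≢z (trans x≡X (sym (h (here refl))))

    allEq-just : ∀ (xs : List S) → allEq xs ≡ just X → X ∈ˡ xs × (∀ {y} → y ∈ˡ xs → y ≡ X)
    allEq-just (x ∷ xs) = allEq∷-just x xs

    allEq-nothing : ∀ (xs : List S) → allEq xs ≡ nothing → X ∈ˡ xs → ¬ (∀ {y} → y ∈ˡ xs → y ≡ X)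
    allEq-nothing (x ∷ xs) e _ h = allEq∷-nothing x xs e (h (here refl)) (λ m → h (there m))

  uniform-just : uniform s ≡ just X → Uniform s X
  uniform-just {s} e = let m , h = allEq-just (leaves s) e in uniformly m h

  uniform-nothing : uniform s ≡ nothing → ¬ Uniform s X
  uniform-nothing {s} e (uniformly m h) = allEq-nothing (leaves s) e m h

  SameLeaves : T → T → Set
  SameLeaves s t = leaves s ≋ leaves t

  Uniform-unique : uniform s ≡ just X → Uniform s Y → Y ≡ X
  Uniform-unique {s} eq u = Uniform.leaves-≡ (uniform-just {s} eq) (Uniform.∈-leaves u)

  Uniform-≋ : SameLeaves s t → Uniform s X → Uniform t X
  Uniform-≋ (f , g) (uniformly m h) = uniformly (f m) (λ m′ → h (g m′))

  Uniform-leaf : Uniform (leaf X) Y → X ≡ Y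
  Uniform-leaf (uniformly (here refl) _) = refl

  Uniform-frontier : Uniform s X → Frontier s L → X ∈ˡ L × (∀ {y} → y ∈ˡ L → y ≡ X)
  Uniform-frontier (uniformly m h) f = frontier-∈⁺ f m , λ y∈ → h (frontier-∈⁻ f y∈)

  -- Every reduction step turns a leaf order L of the old tree into a leaf
  -- order L′ of the new one with L ⇛ L′; hence consecutiveness transfers.
  _⇛_ : List S → List S → Set₁
  L ⇛ L′ = ∀ {P : S → Set} {s e} → Run P s L e → Run P s L′ e

  ⇛-++ : ∀ {A A′ B B′} → A ⇛ A′ → B ⇛ B′ → (A ++ B) ⇛ (A′ ++ B′)
  ⇛-++ {A} f g r = let _ , r₁ , r₂ = run-++⁻ A r in run-++⁺ (f r₁) (g r₂)

  ⇛-block : ∀ {F} R → X ∈ˡ F → (∀ {y} → y ∈ˡ F → y ≡ X) → (F ++ R) ⇛ (X ∷ R)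
  ⇛-block {F = y ∷ F} R _ h r with h (here refl)
  ... | refl = run-absorb F (All.tabulate (λ m → h (there m))) r

  Uniform⇛ : Uniform s X → Frontier s L → L ⇛ [ X ]
  Uniform⇛ {L = L} u f r =
    let m , h = Uniform-frontier u f in ⇛-block [] m h (subst (λ z → Run _ _ z _) (sym (++-identityʳ L)) r)

  module Pullback {ℓ : Level} (φ : T → T) (_∼_ : List S → List S → Set ℓ)
                  (∼-[] : [] ∼ []) (∼-++ : ∀ {A A′ B B′} → A ∼ A′ → B ∼ B′ → (A ++ B) ∼ (A′ ++ B′)) where

    PullsBack : T → Set ℓ
    PullsBack c = ∀ {L′} → Frontier (φ c) L′ → ∃ λ L → Frontier c L × L ∼ L′

    pullbackL : ∀ (cs : List T) → All PullsBack cs → FrontierL (map φ cs) L′ → ∃ λ L → FrontierL cs L × L ∼ L′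
    pullbackL []       []       fl-[]       = [] , fl-[] , ∼-[]
    pullbackL (c ∷ cs) (g ∷ gs) (fl-∷ f fs) =
      let L₁ , f₁ , r₁ = g f ; L₂ , f₂ , r₂ = pullbackL cs gs fs in L₁ ++ L₂ , fl-∷ f₁ f₂ , ∼-++ r₁ r₂

    pullback-pnode : ∀ (cs : List T) → All PullsBack cs → map φ cs ↭ ds → FrontierL ds L′ →
      ∃ λ L → Frontier (pnode cs) L × L ∼ L′
    pullback-pnode cs gs π fl with ↭-map-inv φ π
    ... | es , refl , π′ = let L , f , r = pullbackL es (All-resp-↭ π′ gs) fl in L , f-p π′ f , r

    pullback-qnode : ∀ (cs : List T) → All PullsBack cs → FrontierL (map φ cs) L′ →
      ∃ λ L → Frontier (qnode cs) L × L ∼ L′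
    pullback-qnode cs gs fl = let L , f , r = pullbackL cs gs fl in L , f-q f , r

    pullback-qnode-rev : ∀ (cs : List T) → All PullsBack cs → FrontierL (reverse (map φ cs)) L′ →
      ∃ λ L → Frontier (qnode cs) L × L ∼ L′
    pullback-qnode-rev cs gs fl =
      let L , f , r = pullbackL (reverse cs) (All.tabulate (λ m → All.lookup gs (Any.reverse⁻ m)))
                                (subst (λ z → FrontierL z _) (sym (reverse-map φ cs)) fl)
      in L , f-qrev f , r

  module _ (I : S) where

    restrictL≡map : ∀ (cs : List T) → restrictL I cs ≡ map (restrict I) cs
    restrictL≡map []       = refl
    restrictL≡map (c ∷ cs) = cong (restrict I c ∷_) (restrictL≡map cs)

    mutual
      leaves-restrict : ∀ (s : T) → leaves (restrict I s) ≡ map (_∩ I) (leaves s)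
      leaves-restrict (leaf x)   = refl
      leaves-restrict (pnode cs) = leavesL-restrict cs
      leaves-restrict (qnode cs) = leavesL-restrict cs

      leavesL-restrict : ∀ (cs : List T) → leavesL (restrictL I cs) ≡ map (_∩ I) (leavesL cs)
      leavesL-restrict []       = refl
      leavesL-restrict (c ∷ cs) =
        trans (cong₂ _++_ (leaves-restrict c) (leavesL-restrict cs)) (sym (map-++ (_∩ I) (leaves c) (leavesL cs)))

    private
      _∼ᵣ_ : List S → List S → Set
      L ∼ᵣ L′ = L′ ≡ map (_∩ I) L

      ∼ᵣ-++ : ∀ {A A′ B B′} → A ∼ᵣ A′ → B ∼ᵣ B′ → (A ++ B) ∼ᵣ (A′ ++ B′)
      ∼ᵣ-++ {A} {B = B} refl refl = sym (map-++ (_∩ I) A B)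

    open Pullback (restrict I) _∼ᵣ_ refl ∼ᵣ-++

    mutual
      pullback-restrict : ∀ (s : T) → Frontier (restrict I s) L′ → ∃ λ L → Frontier s L × L′ ≡ map (_∩ I) L
      pullback-restrict (leaf x)   (f-leaf _)  = _ , f-leaf x , refl
      pullback-restrict (pnode cs) (f-p π fl)  =
        pullback-pnode cs (pullback-restrictL cs) (subst (_↭ _) (restrictL≡map cs) π) fl
      pullback-restrict (qnode cs) (f-q fl)    =
        pullback-qnode cs (pullback-restrictL cs) (subst (λ z → FrontierL z _) (restrictL≡map cs) fl)
      pullback-restrict (qnode cs) (f-qrev fl) =
        pullback-qnode-rev cs (pullback-restrictL cs) (subst (λ z → FrontierL (reverse z) _) (restrictL≡map cs) fl)

      pullback-restrictL : ∀ (cs : List T) → All PullsBack cs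
      pullback-restrictL []       = []
      pullback-restrictL (c ∷ cs) = pullback-restrict c ∷ pullback-restrictL cs

  Uniform-collapse : Uniform s X → [ X ] ≋ leaves s
  Uniform-collapse (uniformly m h) = (λ { (here refl) → m }) , λ m′ → here (h m′)

  phase1L≡map : ∀ (cs : List T) → phase1L cs ≡ map phase1 cs
  phase1L≡map []       = refl
  phase1L≡map (c ∷ cs) = cong (phase1 c ∷_) (phase1L≡map cs)

  module _ where
    open Pullback phase1 _⇛_ (λ r → r) ⇛-++

    mutual
      pullback-phase1 : ∀ (s : T) → Frontier (phase1 s) L′ → ∃ λ L → Frontier s L × L ⇛ L′
      pullback-phase1 (leaf x) (f-leaf _) = _ , f-leaf x , λ r → r
      pullback-phase1 (pnode cs) f with uniform (pnode cs) in eq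
      pullback-phase1 (pnode cs) (f-leaf X) | just X =
        let L , f = frontier (pnode cs) in L , f , Uniform⇛ (uniform-just {pnode cs} eq) f
      pullback-phase1 (pnode cs) (f-p π fl) | nothing =
        pullback-pnode cs (pullback-phase1L cs) (subst (_↭ _) (phase1L≡map cs) π) fl
      pullback-phase1 (qnode cs) f with uniform (qnode cs) in eq
      pullback-phase1 (qnode cs) (f-leaf X) | just X =
        let L , f = frontier (qnode cs) in L , f , Uniform⇛ (uniform-just {qnode cs} eq) f
      pullback-phase1 (qnode cs) (f-q fl) | nothing =
        pullback-qnode cs (pullback-phase1L cs) (subst (λ z → FrontierL z _) (phase1L≡map cs) fl)
      pullback-phase1 (qnode cs) (f-qrev fl) | nothing =
        pullback-qnode-rev cs (pullback-phase1L cs) (subst (λ z → FrontierL (reverse z) _) (phase1L≡map cs) fl)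

      pullback-phase1L : ∀ (cs : List T) → All PullsBack cs
      pullback-phase1L []       = []
      pullback-phase1L (c ∷ cs) = pullback-phase1 c ∷ pullback-phase1L cs

  mutual
    leaves-phase1 : ∀ (s : T) → SameLeaves (phase1 s) s
    leaves-phase1 (leaf y) = ⊆-refl , ⊆-refl
    leaves-phase1 (pnode cs) with uniform (pnode cs) in eq
    ... | just X  = Uniform-collapse (uniform-just {pnode cs} eq)
    ... | nothing = leavesL-phase1 cs
    leaves-phase1 (qnode cs) with uniform (qnode cs) in eq
    ... | just X  = Uniform-collapse (uniform-just {qnode cs} eq)
    ... | nothing = leavesL-phase1 cs

    leavesL-phase1 : ∀ (cs : List T) → leavesL (phase1L cs) ≋ leavesL cs
    leavesL-phase1 []       = ⊆-refl , ⊆-refl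
    leavesL-phase1 (c ∷ cs) = ≋-++ (leaves-phase1 c) (leavesL-phase1 cs)

  data MergeStep : List T → List T → Set where
    merge : ∀ A B c d X → Uniform c X → Uniform d X → MergeStep (A ++ c ∷ d ∷ B) (A ++ leaf X ∷ B)

  Merges : List T → List T → Set
  Merges = Star MergeStep

  consMerge-merges : ∀ (c : T) ds → Merges (c ∷ ds) (consMerge c ds)
  consMerge-merges c [] = ε
  consMerge-merges c (d ∷ ds) with uniform c in eq₁ | uniform d in eq₂
  ... | just X  | just Y with ≡-dec Bool._≟_ X Y
  ...   | yes refl = merge [] ds c d X (uniform-just {c} eq₁) (uniform-just {d} eq₂) ◅ ε
  ...   | no _     = ε
  consMerge-merges c (d ∷ ds) | just X  | nothing = ε
  consMerge-merges c (d ∷ ds) | nothing | _       = ε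

  mergeRuns-merges : ∀ (cs : List T) → Merges cs (mergeRuns cs)
  mergeRuns-merges []       = ε
  mergeRuns-merges (c ∷ cs) =
    gmap (c ∷_) (λ { (merge A B a b X ua ub) → merge (c ∷ A) B a b X ua ub }) (mergeRuns-merges cs)
    ◅◅ consMerge-merges c (mergeRuns cs)

  private
    reverse-++₃ : ∀ (A : List T) xs B → reverse (A ++ xs ++ B) ≡ reverse B ++ reverse xs ++ reverse A
    reverse-++₃ A xs B =
      trans (reverse-++ A (xs ++ B)) (trans (cong (_++ reverse A) (reverse-++ xs B)) (++-assoc (reverse B) (reverse xs) (reverse A)))

  mergeStep-reverse : MergeStep cs ds → MergeStep (reverse cs) (reverse ds)
  mergeStep-reverse (merge A B c d X uc ud) =
    subst₂ MergeStep (sym (reverse-++₃ A (c ∷ d ∷ []) B)) (sym (reverse-++₃ A [ leaf X ] B))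
      (merge (reverse B) (reverse A) d c X ud uc)

  mergeStep-pullback : MergeStep cs ds → FrontierL ds L′ → ∃ λ L → FrontierL cs L × L ⇛ L′
  mergeStep-pullback (merge A B c d X uc ud) fl with frontierL-++⁻ A fl
  ... | L₁ , _ , refl , fA , fl-∷ (f-leaf .X) fB with frontier c | frontier d
  ... | Lc , fc | Ld , fd =
    L₁ ++ Lc ++ Ld ++ _ , frontierL-++ fA (fl-∷ fc (fl-∷ fd fB)) ,
    ⇛-++ {A = L₁} (λ r → r) (λ r → ⇛-block _ (∈-++⁺ˡ mc) all-X (subst (λ z → Run _ _ z _) (sym (++-assoc Lc Ld _)) r))
    where
    mc : X ∈ˡ Lc
    mc = proj₁ (Uniform-frontier uc fc)
    all-X : ∀ {y} → y ∈ˡ Lc ++ Ld → y ≡ X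
    all-X y∈ with ∈-++⁻ Lc y∈
    ... | inj₁ m = proj₂ (Uniform-frontier uc fc) m
    ... | inj₂ m = proj₂ (Uniform-frontier ud fd) m

  merges-pullback : Merges cs ds → FrontierL ds L′ → ∃ λ L → FrontierL cs L × L ⇛ L′
  merges-pullback ε        fl = _ , fl , λ r → r
  merges-pullback (m ◅ ms) fl =
    let _ , f′ , g = merges-pullback ms fl ; L , f , h = mergeStep-pullback m f′ in L , f , λ r → g (h r)

  leavesL-++ : ∀ (cs ds : List T) → leavesL (cs ++ ds) ≡ leavesL cs ++ leavesL ds
  leavesL-++ []       ds = refl
  leavesL-++ (c ∷ cs) ds = trans (cong (leaves c ++_) (leavesL-++ cs ds)) (sym (++-assoc (leaves c) _ _))

  mergeStep-leaves : MergeStep cs ds → leavesL cs ≋ leavesL ds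
  mergeStep-leaves (merge A B c d X (uniformly mc hc) (uniformly md hd)) =
    subst₂ _≋_ (sym (leavesL-++ A _)) (sym (leavesL-++ A _)) (≋-++ {ws = leavesL A} (⊆-refl , ⊆-refl) (collapse , expand))
    where
    collapse : leaves c ++ leaves d ++ leavesL B ⊆ˡ X ∷ leavesL B
    collapse m with ∈-++⁻ (leaves c) m
    ... | inj₁ m₁ = here (hc m₁)
    ... | inj₂ m₂ with ∈-++⁻ (leaves d) m₂
    ...   | inj₁ m₃ = here (hd m₃)
    ...   | inj₂ m₄ = there m₄
    expand : X ∷ leavesL B ⊆ˡ leaves c ++ leaves d ++ leavesL B
    expand (here refl) = ∈-++⁺ˡ mc
    expand (there m)   = ∈-++⁺ʳ (leaves c) (∈-++⁺ʳ (leaves d) m)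

  merges-leaves : Merges cs ds → leavesL cs ≋ leavesL ds
  merges-leaves ε        = ⊆-refl , ⊆-refl
  merges-leaves (m ◅ ms) = ≋-trans (mergeStep-leaves m) (merges-leaves ms)

  merges-All : ∀ {Q : T → Set} → (∀ {X} → Q (leaf X)) → Merges cs ds → All Q cs → All Q ds
  merges-All QX ε                                qs = qs
  merges-All QX (merge A B c d X _ _ ◅ ms) qs with All.++⁻ A qs
  ... | qA , _ ∷ _ ∷ qB = merges-All QX ms (All.++⁺ qA (QX ∷ qB))

  phase2L≡map : ∀ (cs : List T) → phase2L cs ≡ map phase2 cs
  phase2L≡map []       = refl
  phase2L≡map (c ∷ cs) = cong (phase2 c ∷_) (phase2L≡map cs)

  module _ where
    open Pullback phase2 _⇛_ (λ r → r) ⇛-++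

    mutual
      pullback-phase2 : ∀ (s : T) → Frontier (phase2 s) L′ → ∃ λ L → Frontier s L × L ⇛ L′
      pullback-phase2 (leaf x)   (f-leaf _) = _ , f-leaf x , λ r → r
      pullback-phase2 (pnode cs) (f-p π fl) =
        pullback-pnode cs (pullback-phase2L cs) (subst (_↭ _) (phase2L≡map cs) π) fl
      pullback-phase2 (qnode cs) (f-q fl) =
        let M , fm , g = merges-pullback (mergeRuns-merges (phase2L cs)) fl
            L , f , h = pullback-qnode cs (pullback-phase2L cs) (subst (λ z → FrontierL z M) (phase2L≡map cs) fm)
        in L , f , λ r → g (h r)
      pullback-phase2 (qnode cs) (f-qrev fl) =
        let M , fm , g = merges-pullback (gmap reverse mergeStep-reverse (mergeRuns-merges (phase2L cs))) fl
            L , f , h = pullback-qnode-rev cs (pullback-phase2L cs) (subst (λ z → FrontierL (reverse z) M) (phase2L≡map cs) fm)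
        in L , f , λ r → g (h r)

      pullback-phase2L : ∀ (cs : List T) → All PullsBack cs
      pullback-phase2L []       = []
      pullback-phase2L (c ∷ cs) = pullback-phase2 c ∷ pullback-phase2L cs

  mutual
    leaves-phase2 : ∀ (s : T) → SameLeaves (phase2 s) s
    leaves-phase2 (leaf y)   = ⊆-refl , ⊆-refl
    leaves-phase2 (pnode cs) = leavesL-phase2 cs
    leaves-phase2 (qnode cs) = ≋-trans (swap (merges-leaves (mergeRuns-merges (phase2L cs)))) (leavesL-phase2 cs)

    leavesL-phase2 : ∀ (cs : List T) → leavesL (phase2L cs) ≋ leavesL cs
    leavesL-phase2 []       = ⊆-refl , ⊆-refl
    leavesL-phase2 (c ∷ cs) = ≋-++ (leaves-phase2 c) (leavesL-phase2 cs)

  module _ (I : S) where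

    pullback-IReduced : ∀ (s : T) → Frontier (IReduced I s) L′ →
      ∃ λ L → Frontier s L × (∀ {t} → t ∈ I → Consecutive (t ∈_) L → Consecutive (t ∈_) L′)
    pullback-IReduced s f with pullback-phase2 (phase1 (restrict I s)) f
    ... | _ , f₂ , g₂ with pullback-phase1 (restrict I s) f₂
    ... | _ , f₁ , g₁ with pullback-restrict I s f₁
    ... | L , f₀ , refl = L , f₀ , λ t∈I (e , r) →
      e , g₂ (g₁ (run-map (_∩ I) (λ t∈x → x∈p∩q⁺ (t∈x , t∈I)) (λ t∈ → proj₁ (x∈p∩q⁻ _ I t∈)) r))

    leaves-IReduced : ∀ (s : T) → leaves (IReduced I s) ≋ map (_∩ I) (leaves s)
    leaves-IReduced s =
      subst (λ z → leaves (IReduced I s) ≋ z) (leaves-restrict I s)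
        (≋-trans (leaves-phase2 (phase1 (restrict I s))) (leaves-phase1 (restrict I s)))

-- Invariants of the reduced tree

module _ {N : ℕ} where

  private
    S : Set
    S = Subset N
    T : Set
    T = PQ S

  private variable
    s c d : T
    X Y : S

  mutual
    every-restrict : ∀ {Pr : T → Set} I → (∀ {s} → Pr s → Pr (restrict I s)) →
      ∀ (s : T) → Every Pr s → Every Pr (restrict I s)
    every-restrict I keep (leaf x)   (every p _)  = every (keep p) []
    every-restrict I keep (pnode cs) (every p ps) = every (keep p) (every-restrictL I keep cs ps)
    every-restrict I keep (qnode cs) (every p ps) = every (keep p) (every-restrictL I keep cs ps)

    every-restrictL : ∀ {Pr : T → Set} I → (∀ {s} → Pr s → Pr (restrict I s)) →
      ∀ (cs : List T) → All (Every Pr) cs → All (Every Pr) (restrictL I cs)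
    every-restrictL I keep []       []       = []
    every-restrictL I keep (c ∷ cs) (p ∷ ps) = every-restrict I keep c p ∷ every-restrictL I keep cs ps

  mutual
    every-phase1 : ∀ {Pr : T → Set} → (∀ {X} → Pr (leaf X)) → (∀ {s} → Pr s → Pr (phase1 s)) →
      ∀ (s : T) → Every Pr s → Every Pr (phase1 s)
    every-phase1 PrX keep (leaf x) (every p _) = every (keep p) []
    every-phase1 PrX keep (pnode cs) (every p ps) with uniform (pnode cs) | keep {pnode cs} p
    ... | just X  | _  = every PrX []
    ... | nothing | p′ = every p′ (every-phase1L PrX keep cs ps)
    every-phase1 PrX keep (qnode cs) (every p ps) with uniform (qnode cs) | keep {qnode cs} p
    ... | just X  | _  = every PrX []
    ... | nothing | p′ = every p′ (every-phase1L PrX keep cs ps)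

    every-phase1L : ∀ {Pr : T → Set} → (∀ {X} → Pr (leaf X)) → (∀ {s} → Pr s → Pr (phase1 s)) →
      ∀ (cs : List T) → All (Every Pr) cs → All (Every Pr) (phase1L cs)
    every-phase1L PrX keep []       []       = []
    every-phase1L PrX keep (c ∷ cs) (p ∷ ps) = every-phase1 PrX keep c p ∷ every-phase1L PrX keep cs ps

  mutual
    every-phase2 : ∀ {Pr : T → Set} → (∀ {X} → Pr (leaf X)) → (∀ {s} → Pr s → Pr (phase2 s)) →
      ∀ (s : T) → Every Pr s → Every Pr (phase2 s)
    every-phase2 PrX keep (leaf x)   (every p _)  = every (keep p) []
    every-phase2 PrX keep (pnode cs) (every p ps) = every (keep p) (every-phase2L PrX keep cs ps)
    every-phase2 PrX keep (qnode cs) (every p ps) =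
      every (keep p) (merges-All (every PrX []) (mergeRuns-merges (phase2L cs)) (every-phase2L PrX keep cs ps))

    every-phase2L : ∀ {Pr : T → Set} → (∀ {X} → Pr (leaf X)) → (∀ {s} → Pr s → Pr (phase2 s)) →
      ∀ (cs : List T) → All (Every Pr) cs → All (Every Pr) (phase2L cs)
    every-phase2L PrX keep []       []       = []
    every-phase2L PrX keep (c ∷ cs) (p ∷ ps) = every-phase2 PrX keep c p ∷ every-phase2L PrX keep cs ps

  HasLeaf : T → Set
  HasLeaf s = ∃ (_∈ˡ leaves s)

  private
    hasLeaf-head : ∀ {cs : List T} → All (Every HasLeaf) (c ∷ cs) → ∃ (_∈ˡ leavesL (c ∷ cs))
    hasLeaf-head (every (x , m) _ ∷ _) = x , ∈-++⁺ˡ m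

  mutual
    proper⇒hasLeaf : ∀ (s : T) → Proper s → Every HasLeaf s
    proper⇒hasLeaf (leaf x) _ = every (x , here refl) []
    proper⇒hasLeaf (pnode []) (() , _)
    proper⇒hasLeaf (qnode []) (() , _)
    proper⇒hasLeaf (pnode (c ∷ cs)) (_ , ps) = let hs = properL⇒hasLeaf (c ∷ cs) ps in every (hasLeaf-head hs) hs
    proper⇒hasLeaf (qnode (c ∷ cs)) (_ , ps) = let hs = properL⇒hasLeaf (c ∷ cs) ps in every (hasLeaf-head hs) hs

    properL⇒hasLeaf : ∀ (cs : List T) → ProperL cs → All (Every HasLeaf) cs
    properL⇒hasLeaf []       _        = []
    properL⇒hasLeaf (c ∷ cs) (p , ps) = proper⇒hasLeaf c p ∷ properL⇒hasLeaf cs ps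

  hasLeaf-IReduced : ∀ I (s : T) → Proper s → Every HasLeaf (IReduced I s)
  hasLeaf-IReduced I s p =
    every-phase2 (_ , here refl) (λ {s} (x , m) → x , proj₂ (leaves-phase2 s) m) _
      (every-phase1 (_ , here refl) (λ {s} (x , m) → x , proj₂ (leaves-phase1 s) m) _
        (every-restrict I (λ {s} (x , m) → x ∩ I , subst (x ∩ I ∈ˡ_) (sym (leaves-restrict I s)) (∈-map⁺ (_∩ I) m)) s
          (proper⇒hasLeaf s p)))

  NonUniform : T → Set
  NonUniform (leaf _)   = ⊤
  NonUniform (pnode cs) = ∀ {X} → ¬ Uniform (pnode cs) X
  NonUniform (qnode cs) = ∀ {X} → ¬ Uniform (qnode cs) X

  mutual
    nonUniform-phase1 : ∀ (s : T) → Every NonUniform (phase1 s)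
    nonUniform-phase1 (leaf x) = every tt []
    nonUniform-phase1 (pnode cs) with uniform (pnode cs) in eq
    ... | just X  = every tt []
    ... | nothing = every (λ u → uniform-nothing {s = pnode cs} eq (Uniform-≋ (leavesL-phase1 cs) u)) (nonUniform-phase1L cs)
    nonUniform-phase1 (qnode cs) with uniform (qnode cs) in eq
    ... | just X  = every tt []
    ... | nothing = every (λ u → uniform-nothing {s = qnode cs} eq (Uniform-≋ (leavesL-phase1 cs) u)) (nonUniform-phase1L cs)

    nonUniform-phase1L : ∀ (cs : List T) → All (Every NonUniform) (phase1L cs)
    nonUniform-phase1L []       = []
    nonUniform-phase1L (c ∷ cs) = nonUniform-phase1 c ∷ nonUniform-phase1L cs

  nonUniform-IReduced : ∀ I (s : T) → Every NonUniform (IReduced I s)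
  nonUniform-IReduced I s = every-phase2 tt keep _ (nonUniform-phase1 (restrict I s))
    where
    keep : ∀ {s} → NonUniform s → NonUniform (phase2 s)
    keep {leaf _}   _  = tt
    keep {pnode cs} nu = λ u → nu (Uniform-≋ (leaves-phase2 (pnode cs)) u)
    keep {qnode cs} nu = λ u → nu (Uniform-≋ (leaves-phase2 (qnode cs)) u)

  Apart : T → T → Set
  Apart c d = ∀ {X} → Uniform c X → ¬ Uniform d X

  ApartNeighbours : T → Set
  ApartNeighbours (qnode cs) = Linked Apart cs
  ApartNeighbours _          = ⊤

  private
    apart-collapse : ∀ {ds} → Uniform d X → Linked Apart (d ∷ ds) → Linked Apart (leaf X ∷ ds)
    apart-collapse ud [-]      = [-]
    apart-collapse ud (h ∷ ap) = (λ u → h (subst (Uniform _) (Uniform-leaf u) ud)) ∷ ap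

  consMerge-apart : ∀ (c : T) ds → Linked Apart ds → Linked Apart (consMerge c ds)
  consMerge-apart c []       _  = [-]
  consMerge-apart c (d ∷ ds) ap with uniform c in eq₁ | uniform d in eq₂
  ... | just X  | just Y with ≡-dec Bool._≟_ X Y
  ...   | yes refl = apart-collapse (uniform-just {s = d} eq₂) ap
  ...   | no X≢Y   = (λ uc ud → X≢Y (trans (sym (Uniform-unique {s = c} eq₁ uc)) (Uniform-unique {s = d} eq₂ ud))) ∷ ap
  consMerge-apart c (d ∷ ds) ap | just X  | nothing = (λ _ ud → uniform-nothing {s = d} eq₂ ud) ∷ ap
  consMerge-apart c (d ∷ ds) ap | nothing | _       = (λ uc _ → uniform-nothing {s = c} eq₁ uc) ∷ ap

  mergeRuns-apart : ∀ (cs : List T) → Linked Apart (mergeRuns cs)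
  mergeRuns-apart []       = []
  mergeRuns-apart (c ∷ cs) = consMerge-apart c (mergeRuns cs) (mergeRuns-apart cs)

  mutual
    apart-phase2 : ∀ (s : T) → Every ApartNeighbours (phase2 s)
    apart-phase2 (leaf x)   = every tt []
    apart-phase2 (pnode cs) = every tt (apart-phase2L cs)
    apart-phase2 (qnode cs) =
      every (mergeRuns-apart (phase2L cs)) (merges-All (every tt []) (mergeRuns-merges (phase2L cs)) (apart-phase2L cs))

    apart-phase2L : ∀ (cs : List T) → All (Every ApartNeighbours) (phase2L cs)
    apart-phase2L []       = []
    apart-phase2L (c ∷ cs) = apart-phase2 c ∷ apart-phase2L cs

module _ {N : ℕ} where

  private
    S : Set
    S = Subset N

  ∈-⋂⁻ : ∀ {u} (xs : List S) → u ∈ ⋂ xs → All (u ∈_) xs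
  ∈-⋂⁻ []       _ = []
  ∈-⋂⁻ (x ∷ xs) m = let u∈x , u∈⋂ = x∈p∩q⁻ x (⋂ xs) m in u∈x ∷ ∈-⋂⁻ xs u∈⋂

  ∈-⋂⁺ : ∀ {u} {xs : List S} → All (u ∈_) xs → u ∈ ⋂ xs
  ∈-⋂⁺ []         = ∈⊤
  ∈-⋂⁺ (p ∷ ps)   = x∈p∩q⁺ (p , ∈-⋂⁺ ps)

  ⊆∧∣≥∣⇒⊇ : ∀ {X Z : S} → X ⊆ Z → ∣ Z ∣ ≤ ∣ X ∣ → Z ⊆ X
  ⊆∧∣≥∣⇒⊇ {X} {Z} X⊆Z ∣Z∣≤∣X∣ with Z ⊆? X
  ... | yes Z⊆X = Z⊆X
  ... | no Z⊈X with Fin.any? (λ v → (v ∈? Z) ×-dec ¬? (v ∈? X))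
  ...   | yes (v , v∈Z , v∉X) =
    ⊥-elim (<-irrefl refl (<-≤-trans (p⊂q⇒∣p∣<∣q∣ (X⊆Z , v , v∈Z , v∉X)) ∣Z∣≤∣X∣))
  ...   | no ∄v = ⊥-elim (Z⊈X λ {v} v∈Z → case v∈Z)
    where
    case : ∀ {v} → v ∈ Z → v ∈ X
    case {v} v∈Z with v ∈? X
    ... | yes v∈X = v∈X
    ... | no v∉X  = ⊥-elim (∄v (v , v∈Z , v∉X))

  largest : ∀ {Y} (xs : List S) → Y ∈ˡ xs → ∃ λ X → X ∈ˡ xs × (∀ {W} → W ∈ˡ xs → ∣ W ∣ ≤ ∣ X ∣)
  largest (x ∷ xs) _ = argmax ∣_∣ x xs , member (argmax-sel ∣_∣ x xs) , bound
    where
    member : argmax ∣_∣ x xs ≡ x ⊎ argmax ∣_∣ x xs ∈ˡ xs → argmax ∣_∣ x xs ∈ˡ x ∷ xs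
    member (inj₁ e) = here e
    member (inj₂ m) = there m
    bound : ∀ {W} → W ∈ˡ x ∷ xs → ∣ W ∣ ≤ ∣ argmax ∣_∣ x xs ∣
    bound (here refl) = f[⊥]≤f[argmax] {f = ∣_∣} x xs
    bound (there m)   = All.lookup (f[xs]≤f[argmax] {f = ∣_∣} x xs) m

  module _ (G : Graph N) where

    private
      Extends : S → Fin N → Set
      Extends Y v = v ∈ V G × v ∉ Y × (∀ u → u ∈ Y → u ≢ v → Adj G u v)

      extends? : ∀ Y v → Dec (Extends Y v)
      extends? Y v = (v ∈? V G) ×-dec ¬? (v ∈? Y) ×-dec
        Fin.all? (λ u → (u ∈? Y) →-dec (¬? (u Fin.≟ v) →-dec (E G u v Bool.≟ true)))

      clique-∪ : ∀ {Y v} → IsClique (V G) (Adj G) Y → Extends Y v → IsClique (V G) (Adj G) (Y ∪ ⁅ v ⁆)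
      clique-∪ {Y} {v} (Y⊆V , adj) (v∈V , _ , v-adj) = ⊆V , adj′
        where
        split : ∀ {x} → x ∈ Y ∪ ⁅ v ⁆ → x ∈ Y ⊎ x ≡ v
        split m with x∈p∪q⁻ Y ⁅ v ⁆ m
        ... | inj₁ x∈Y = inj₁ x∈Y
        ... | inj₂ x∈v = inj₂ (x∈⁅y⁆⇒x≡y v x∈v)
        ⊆V : Y ∪ ⁅ v ⁆ ⊆ V G
        ⊆V m with split m
        ... | inj₁ x∈Y = Y⊆V x∈Y
        ... | inj₂ refl = v∈V
        adj′ : ∀ u w → u ∈ Y ∪ ⁅ v ⁆ → w ∈ Y ∪ ⁅ v ⁆ → u ≢ w → Adj G u w
        adj′ u w mu mw u≢w with split mu | split mw
        ... | inj₁ u∈Y | inj₁ w∈Y = adj u w u∈Y w∈Y u≢w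
        ... | inj₁ u∈Y | inj₂ refl = v-adj u u∈Y u≢w
        ... | inj₂ refl | inj₁ w∈Y = trans (E-sym G u w) (v-adj w w∈Y (λ e → u≢w (sym e)))
        ... | inj₂ refl | inj₂ refl = ⊥-elim (u≢w refl)

    private
      extend : ∀ k Y → IsClique (V G) (Adj G) Y → N ≤ ∣ Y ∣ + k → ∃ λ Q → MaxCliqueOf G Q × Y ⊆ Q
      extend k Y cl fuel with Fin.any? (extends? Y)
      ... | no ∄v = Y , (cl , maximal) , λ m → m
        where
        maximal : ∀ Y′ → IsClique (V G) (Adj G) Y′ → Y ⊆ Y′ → Y′ ⊆ Y
        maximal Y′ (Y′⊆V , adj) Y⊆Y′ {v} v∈Y′ with v ∈? Y
        ... | yes v∈Y = v∈Y
        ... | no v∉Y  = ⊥-elim (∄v (v , Y′⊆V v∈Y′ , v∉Y , λ u u∈Y u≢v → adj u v (Y⊆Y′ u∈Y) v∈Y′ u≢v))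
      ... | yes (v , ext) = continue k fuel
        where
        Y⊆Y′ : Y ⊆ Y ∪ ⁅ v ⁆
        Y⊆Y′ m = x∈p∪q⁺ (inj₁ m)
        grows : ∣ Y ∣ < ∣ Y ∪ ⁅ v ⁆ ∣
        grows = p⊂q⇒∣p∣<∣q∣ (Y⊆Y′ , v , x∈p∪q⁺ (inj₂ (x∈⁅x⁆ v)) , proj₁ (proj₂ ext))
        continue : ∀ k → N ≤ ∣ Y ∣ + k → ∃ λ Q → MaxCliqueOf G Q × Y ⊆ Q
        continue zero    fuel =
          ⊥-elim (<-irrefl refl (<-≤-trans grows (≤-trans (∣p∣≤n (Y ∪ ⁅ v ⁆)) (subst (N ≤_) (+-identityʳ _) fuel))))
        continue (suc k) fuel =
          let Q , maxQ , Y′⊆Q = extend k (Y ∪ ⁅ v ⁆) (clique-∪ cl ext)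
                                  (≤-trans fuel (subst (_≤ ∣ Y ∪ ⁅ v ⁆ ∣ + k) (sym (+-suc ∣ Y ∣ k)) (+-monoˡ-≤ k grows)))
          in Q , maxQ , λ m → Y′⊆Q (Y⊆Y′ m)

    extend-to-maxClique : ∀ Y → IsClique (V G) (Adj G) Y → ∃ λ Q → MaxCliqueOf G Q × Y ⊆ Q
    extend-to-maxClique Y cl = extend N Y cl (m≤n+m N ∣ Y ∣)

module _ {N : ℕ} where

  private variable
    n c : PQ (Subset N)
    u : Fin N
    i : ℕ

  U-child : children n ‼ i ≡ just c → u ∈ U n → u ∈ U c
  U-child {n = n} e u∈ =
    ∈-⋂⁺ (All.tabulate (λ W∈ → All.lookup (∈-⋂⁻ (leaves n) u∈) (∈-leaves-child {s = n} e W∈)))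

  private
    U-childrenL : ∀ (cs : List (PQ (Subset N))) → (∀ i c → cs ‼ i ≡ just c → u ∈ U c) → All (u ∈_) (leavesL cs)
    U-childrenL cs h = All.tabulate λ W∈ →
      let c , c∈ , W∈c = ∈-leavesL⁻ cs W∈ ; i , e = ∈⇒‼ cs c∈ in All.lookup (∈-⋂⁻ (leaves c) (h i c e)) W∈c

  U-children : (∀ X → n ≢ leaf X) → (∀ i c → children n ‼ i ≡ just c → u ∈ U c) → u ∈ U n
  U-children {n = leaf X}   nonLeaf _ = ⊥-elim (nonLeaf X refl)
  U-children {n = pnode cs} _       h = ∈-⋂⁺ (U-childrenL cs h)
  U-children {n = qnode cs} _       h = ∈-⋂⁺ (U-childrenL cs h)

-- The I-reduced PQ-tree of a graph

module ReducedTree {N : ℕ} (G : Graph N) (I : Subset N) (T : PQ (Subset N)) (isPQ : IsPQTreeOf G T) where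

  private
    S : Set
    S = Subset N
    Tree : Set
    Tree = PQ S

    variable
      L : List S
      X Y Z : S
      t u : Fin N
      i j : ℕ
      p q : Path
      n y c c₁ c₂ : Tree

  𝒯 : Tree
  𝒯 = IReduced I T

  private
    _≟_ : (X Y : S) → Dec (X ≡ Y)
    _≟_ = ≡-dec Bool._≟_

    ordering : Frontier T L → ConsecutiveOrdering G L
    ordering {L} = Equivalence.to (proj₂ isPQ L)

  consecutive-T : ∀ t → Frontier T L → Consecutive (t ∈_) L
  consecutive-T t f = lookupConvex⇒consecutive (t ∈?_) _ (proj₂ (proj₂ (ordering f)) t)

  consecutive-𝒯 : t ∈ I → Frontier 𝒯 L → Consecutive (t ∈_) L
  consecutive-𝒯 t∈I f = let _ , f₀ , keep = pullback-IReduced I T f in keep t∈I (consecutive-T _ f₀)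

  leaf-T⇒maxClique : X ∈ˡ leaves T → MaxCliqueOf G X
  leaf-T⇒maxClique {X} X∈ =
    let L , f = frontier T in Equivalence.to (proj₁ (proj₂ (ordering f)) X) (frontier-∈⁺ f X∈)

  maxClique⇒leaf-T : MaxCliqueOf G X → X ∈ˡ leaves T
  maxClique⇒leaf-T {X} maxX =
    let L , f = frontier T in frontier-∈⁻ f (Equivalence.from (proj₁ (proj₂ (ordering f)) X) maxX)

  leaf-𝒯⇒restricted : X ∈ˡ leaves 𝒯 → ∃ λ Q → MaxCliqueOf G Q × X ≡ Q ∩ I
  leaf-𝒯⇒restricted X∈ with ∈-map⁻ (_∩ I) (proj₁ (leaves-IReduced I T) X∈)
  ... | Q , Q∈ , refl = Q , leaf-T⇒maxClique Q∈ , refl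

  restricted⇒leaf-𝒯 : MaxCliqueOf G X → X ∩ I ∈ˡ leaves 𝒯
  restricted⇒leaf-𝒯 maxX = proj₂ (leaves-IReduced I T) (∈-map⁺ (_∩ I) (maxClique⇒leaf-T maxX))

  leaf-𝒯⇒clique : X ∈ˡ leaves 𝒯 → IsClique (V G ∩ I) (Adj G) X
  leaf-𝒯⇒clique X∈ with leaf-𝒯⇒restricted X∈
  ... | Q , ((Q⊆V , adj) , _) , refl =
    (λ m → let u∈Q , u∈I = x∈p∩q⁻ Q I m in x∈p∩q⁺ (Q⊆V u∈Q , u∈I)) ,
    (λ u v u∈ v∈ u≢v → adj u v (proj₁ (x∈p∩q⁻ Q I u∈)) (proj₁ (x∈p∩q⁻ Q I v∈)) u≢v)

  leaf-𝒯⊆I : X ∈ˡ leaves 𝒯 → X ⊆ I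
  leaf-𝒯⊆I X∈ m = proj₂ (x∈p∩q⁻ _ I (proj₁ (leaf-𝒯⇒clique X∈) m))

  clique⊆leaf-𝒯 : IsClique (V G ∩ I) (Adj G) Y → ∃ λ Z → Z ∈ˡ leaves 𝒯 × Y ⊆ Z
  clique⊆leaf-𝒯 {Y} (Y⊆V∩I , adj) =
    let Q , maxQ , Y⊆Q = extend-to-maxClique G Y ((λ m → proj₁ (x∈p∩q⁻ _ I (Y⊆V∩I m))) , adj)
    in Q ∩ I , restricted⇒leaf-𝒯 maxQ , λ m → x∈p∩q⁺ (Y⊆Q m , proj₂ (x∈p∩q⁻ _ I (Y⊆V∩I m)))

  hasLeaf : 𝒯 at p ≔ n → HasLeaf n
  hasLeaf = every-at (hasLeaf-IReduced I T (proj₁ isPQ))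

  nonUniform : 𝒯 at p ≔ n → NonUniform n
  nonUniform = every-at (nonUniform-IReduced I T)

  apartNeighbours : 𝒯 at p ≔ n → ApartNeighbours n
  apartNeighbours = every-at (apart-phase2 (phase1 (restrict I T)))

  nonLeaf⇒nonUniform : 𝒯 at p ≔ n → (∀ X → n ≢ leaf X) → ¬ Uniform n X
  nonLeaf⇒nonUniform {n = leaf x}   _  nonLeaf _ = nonLeaf x refl
  nonLeaf⇒nonUniform {n = pnode cs} at _       u = nonUniform at u
  nonLeaf⇒nonUniform {n = qnode cs} at _       u = nonUniform at u

  superset-leaves⇒uniform : 𝒯 at p ≔ n → MaxCliqueOfInduced G I X → (∀ {W} → W ∈ˡ leaves n → X ⊆ W) → Uniform n X
  superset-leaves⇒uniform {n = n} {X = X} at (_ , maximal) X⊆ =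
    let W , W∈ = hasLeaf at in uniformly (subst (_∈ˡ _) (all-X W∈) W∈) all-X
    where
    all-X : ∀ {W} → W ∈ˡ leaves n → W ≡ X
    all-X W∈ = ⊆-antisym (maximal _ (leaf-𝒯⇒clique (∈-leaves-at at W∈)) (X⊆ W∈)) (X⊆ W∈)

  InAllLeaves : Fin N → Tree → Set
  InAllLeaves t c = All (t ∈_) (leaves c)

  -- Some arrangement of the children of y lists c₁, then B, then c₂, consecutively.
  Ordered : Tree → Tree → List Tree → Tree → Set
  Ordered y c₁ B c₂ = ∃₂ λ A C → ∀ {L} → FrontierL (A ++ c₁ ∷ B ++ c₂ ∷ C) L → Frontier y L

  ordered-span : ∀ {B} → 𝒯 at q ≔ y → Ordered y c₁ B c₂ → t ∈ I →
    X ∈ˡ leaves c₁ → Z ∈ˡ leaves c₂ → t ∈ X → t ∈ Z →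
    InAllLeaves t c₁ × All (InAllLeaves t) B × InAllLeaves t c₂
  ordered-span {c₁ = c₁} {c₂ = c₂} {t = t} {X = X} {Z = Z} {B = B} at-y (A , C , mk) t∈I X∈ Z∈ t∈X t∈Z =
    all-leaves-after right-of-X X∈ t∈X , All.tabulate middle , all-leaves-before left-of-Z Z∈ t∈Z
    where
    P : S → Set
    P = t ∈_

    LB L₁ L₂ : List S
    LB = proj₁ (frontierL B)
    L₁ = proj₁ (frontier c₁)
    L₂ = proj₁ (frontier c₂)

    layout : ∀ {M₁ M₂} → Frontier c₁ M₁ → Frontier c₂ M₂ →
      ∃₂ λ pre post → Consecutive P (pre ++ M₁ ++ LB ++ M₂ ++ post)
    layout {M₁} {M₂} f₁ f₂ with frontierL A | frontierL C
    ... | LA , fA | LC , fC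
      with frontier-at at-y (mk (frontierL-++ fA (fl-∷ f₁ (frontierL-++ (proj₂ (frontierL B)) (fl-∷ f₂ fC)))))
    ... | pre , post , f = pre ++ LA , LC ++ post , subst (Consecutive P) (reassoc pre LA LC post) (consecutive-𝒯 t∈I f)
      where
      reassoc : ∀ pre LA LC post →
        pre ++ (LA ++ M₁ ++ LB ++ M₂ ++ LC) ++ post ≡ (pre ++ LA) ++ M₁ ++ LB ++ M₂ ++ LC ++ post
      reassoc _ _ _ _ = solve (++-monoid S)

    hit : ∀ {W M} → W ∈ˡ M → t ∈ W → Any P M
    hit W∈ t∈W = Any.map (λ { refl → t∈W }) W∈

    hit-X : Any P L₁
    hit-X = hit (frontier-∈⁺ (proj₂ (frontier c₁)) X∈) t∈X

    hit-Z : Any P L₂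
    hit-Z = hit (frontier-∈⁺ (proj₂ (frontier c₂)) Z∈) t∈Z

    all-between : All P LB
    all-between with layout (proj₂ (frontier c₁)) (proj₂ (frontier c₂))
    ... | pre , post , cons =
      consecutive-between (pre ++ L₁) LB (subst (Consecutive P) (reassoc pre post) cons) (Any.++⁺ʳ pre hit-X) (Any.++⁺ˡ hit-Z)
      where
      reassoc : ∀ pre post → pre ++ L₁ ++ LB ++ L₂ ++ post ≡ (pre ++ L₁) ++ LB ++ L₂ ++ post
      reassoc _ _ = solve (++-monoid S)

    middle : ∀ {c} → c ∈ˡ B → InAllLeaves t c
    middle c∈ = All.tabulate (λ W∈ → All.lookup all-between (frontierL-∈⁺ (proj₂ (frontierL B)) c∈ W∈))

    right-of-X : ∀ {M} → Frontier c₁ M → ∀ U V → M ≡ U ++ X ∷ V → All P V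
    right-of-X f₁ U V refl with layout f₁ (proj₂ (frontier c₂))
    ... | pre , post , cons =
      consecutive-between (pre ++ U ++ [ X ]) V (subst (Consecutive P) (reassoc pre post) cons)
        (Any.++⁺ʳ pre (Any.++⁺ʳ U (here t∈X))) (Any.++⁺ʳ LB (Any.++⁺ˡ hit-Z))
      where
      reassoc : ∀ pre post → pre ++ (U ++ X ∷ V) ++ LB ++ L₂ ++ post ≡ (pre ++ U ++ [ X ]) ++ V ++ LB ++ L₂ ++ post
      reassoc _ _ = solve (++-monoid S)

    left-of-Z : ∀ {M} → Frontier c₂ M → ∀ U V → M ≡ U ++ Z ∷ V → All P U
    left-of-Z f₂ U V refl with layout (proj₂ (frontier c₁)) f₂
    ... | pre , post , cons =
      consecutive-between (pre ++ L₁ ++ LB) U (subst (Consecutive P) (reassoc pre (Z ∷ V) post) cons)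
        (Any.++⁺ʳ pre (Any.++⁺ˡ hit-X)) (here t∈Z)
      where
      reassoc : ∀ pre W post → pre ++ L₁ ++ LB ++ (U ++ W) ++ post ≡ (pre ++ L₁ ++ LB) ++ U ++ W ++ post
      reassoc _ _ _ = solve (++-monoid S)

  private
    Among : Tree → List Tree → Tree → Tree → Set
    Among c₁ B c₂ c = c ≡ c₁ ⊎ c ∈ˡ B ⊎ c ≡ c₂

    among : ∀ {B} → InAllLeaves t c₁ × All (InAllLeaves t) B × InAllLeaves t c₂ →
      ∀ {c} → Among c₁ B c₂ c → InAllLeaves t c
    among (all₁ , _    , _   ) (inj₁ refl)        = all₁
    among (_    , allB , _   ) (inj₂ (inj₁ c∈B))  = All.lookup allB c∈B
    among (_    , _    , all₂) (inj₂ (inj₂ refl)) = all₂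

    pull-to-ends : ∀ (A : List Tree) c₁ B c₂ C → A ++ c₁ ∷ B ++ c₂ ∷ C ↭ c₁ ∷ (A ++ B ++ C) ++ [ c₂ ]
    pull-to-ends A c₁ B c₂ C =
      ↭-trans (shift c₁ A (B ++ c₂ ∷ C)) (prep c₁
        (↭-trans (↭-reflexive (sym (++-assoc A B (c₂ ∷ C))))
        (↭-trans (shift c₂ (A ++ B) C)
        (↭-trans (++-comm [ c₂ ] ((A ++ B) ++ C))
        (↭-reflexive (cong (_++ [ c₂ ]) (++-assoc A B C)))))))

  ordered-pnode : ∀ {cs i j} → i < j → cs ‼ i ≡ just c₁ → cs ‼ j ≡ just c₂ →
    ∃ λ B → Ordered (pnode cs) c₁ B c₂ × (∀ {c} → c ∈ˡ cs → Among c₁ B c₂ c)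
  ordered-pnode {c₁ = c₁} {c₂ = c₂} {cs = cs} i<j e₁ e₂ with ‼-split₂ cs i<j e₁ e₂
  ... | A , B , C , refl , _ = A ++ B ++ C , ([] , [] , f-p π) , classify
    where
    π : A ++ c₁ ∷ B ++ c₂ ∷ C ↭ c₁ ∷ (A ++ B ++ C) ++ [ c₂ ]
    π = pull-to-ends A c₁ B c₂ C
    classify : ∀ {c} → c ∈ˡ cs → Among c₁ (A ++ B ++ C) c₂ c
    classify c∈ with ∈-resp-↭ π c∈
    ... | here refl = inj₁ refl
    ... | there m with ∈-++⁻ (A ++ B ++ C) m
    ...   | inj₁ c∈ABC        = inj₂ (inj₁ c∈ABC)
    ...   | inj₂ (here refl) = inj₂ (inj₂ refl)

  ordered-qnode : ∀ {cs i j} → i < j → cs ‼ i ≡ just c₁ → cs ‼ j ≡ just c₂ →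
    ∃ λ B → Ordered (qnode cs) c₁ B c₂ × (∀ {k c} → i ≤ k → k ≤ j → cs ‼ k ≡ just c → Among c₁ B c₂ c)
  ordered-qnode {cs = cs} i<j e₁ e₂ with ‼-split₂ cs i<j e₁ e₂
  ... | A , B , C , refl , refl , refl = B , (A , C , f-q) , λ i≤k k≤j e → ‼-between A e i≤k k≤j

  Spanned : Fin N → Tree → ℕ → ℕ → Set
  Spanned t y i j =
    (∀ cs → y ≡ pnode cs → InAllLeaves t y) ×
    (∀ cs → y ≡ qnode cs → ∀ k c → i ⊓ j ≤ k → k ≤ i ⊔ j → cs ‼ k ≡ just c → InAllLeaves t c)

  private
    span-< : ∀ {i j} → i < j → 𝒯 at q ≔ y → children y ‼ i ≡ just c₁ → children y ‼ j ≡ just c₂ →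
      t ∈ I → X ∈ˡ leaves c₁ → Z ∈ˡ leaves c₂ → t ∈ X → t ∈ Z →
      (∀ cs → y ≡ pnode cs → InAllLeaves t y) ×
      (∀ cs → y ≡ qnode cs → ∀ k c → i ≤ k → k ≤ j → cs ‼ k ≡ just c → InAllLeaves t c)
    span-< {y = leaf _} _ _ ()
    span-< {y = pnode cs} {t = t} i<j at-y e₁ e₂ t∈I X∈ Z∈ t∈X t∈Z with ordered-pnode i<j e₁ e₂
    ... | B , ord , classify = (λ { _ refl → All.tabulate all-leaves }) , λ _ ()
      where
      all-leaves : ∀ {W} → W ∈ˡ leavesL cs → t ∈ W
      all-leaves W∈ = let c , c∈ , W∈c = ∈-leavesL⁻ cs W∈ in
        All.lookup (among (ordered-span at-y ord t∈I X∈ Z∈ t∈X t∈Z) (classify c∈)) W∈c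
    span-< {y = qnode cs} i<j at-y e₁ e₂ t∈I X∈ Z∈ t∈X t∈Z with ordered-qnode i<j e₁ e₂
    ... | B , ord , classify =
      (λ _ ()) , λ { _ refl k c i≤k k≤j e → among (ordered-span at-y ord t∈I X∈ Z∈ t∈X t∈Z) (classify i≤k k≤j e) }

  fork-span : ∀ q {i j rᵢ rⱼ} → i ≢ j → 𝒯 at (q ++ i ∷ rᵢ) ≔ leaf X → 𝒯 at (q ++ j ∷ rⱼ) ≔ leaf Z →
    t ∈ I → t ∈ X → t ∈ Z → 𝒯 at q ≔ y → Spanned t y i j
  fork-span q {i} {j} i≢j at-X at-Z t∈I t∈X t∈Z at-y
    with at-++-∷⁻ q at-X at-y | at-++-∷⁻ q at-Z at-y | <-cmp i j
  ... | _ | _ | tri≈ _ i≡j _ = ⊥-elim (i≢j i≡j)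
  ... | c₁ , e₁ , X-at | c₂ , e₂ , Z-at | tri< i<j _ _ =
    let P-case , Q-case = span-< i<j at-y e₁ e₂ t∈I (∈-leaves-at X-at (here refl)) (∈-leaves-at Z-at (here refl)) t∈X t∈Z
        i≤j = <⇒≤ i<j
    in P-case , λ cs eq k c lo hi →
         Q-case cs eq k c (subst (_≤ k) (m≤n⇒m⊓n≡m i≤j) lo) (subst (k ≤_) (m≤n⇒m⊔n≡n i≤j) hi)
  ... | c₁ , e₁ , X-at | c₂ , e₂ , Z-at | tri> _ _ j<i =
    let P-case , Q-case = span-< j<i at-y e₂ e₁ t∈I (∈-leaves-at Z-at (here refl)) (∈-leaves-at X-at (here refl)) t∈Z t∈X
        j≤i = <⇒≤ j<i
    in P-case , λ cs eq k c lo hi →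
         Q-case cs eq k c (subst (_≤ k) (m≥n⇒m⊓n≡n j≤i) lo) (subst (k ≤_) (m≥n⇒m⊔n≡m j≤i) hi)

  -- The second alternative is (0) at the node where the paths to n and to Z part.
  below-or-spanning : 𝒯 at p ≔ n → Z ∈ˡ leaves 𝒯 →
    Z ∈ˡ leaves n ⊎ (∀ {t X} → t ∈ I → X ∈ˡ leaves n → t ∈ X → t ∈ Z → InAllLeaves t n)
  below-or-spanning {p = p} {n = n} {Z = Z} at-n Z∈ with ∈-leaves⇒at 𝒯 Z∈
  ... | pz , at-Z with compare p pz
  ... | equal refl with at-functional at-n at-Z
  ...   | refl = inj₁ (here refl)
  below-or-spanning {p = p} at-n Z∈ | pz , at-Z | below i r refl with at-++⁻ p at-Z
  ... | n′ , at-n′ , Z-at with at-functional at-n′ at-n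
  ...   | refl = inj₁ (∈-leaves-at Z-at (here refl))
  below-or-spanning at-n Z∈ | pz , at-Z | above i r refl with at-++⁻ pz at-n
  ... | y , at-y , n-at with at-functional at-y at-Z
  ...   | refl = ⊥-elim (leaf-at-∷ n-at)
  below-or-spanning {n = n} {Z = Z} at-n Z∈ | pz , at-Z | fork r i j rᵢ rⱼ i≢j refl refl with at-++⁻ r at-n
  ... | y , at-y , there _ e n-at = inj₂ spanning
    where
    spanning : ∀ {t X} → t ∈ I → X ∈ˡ leaves n → t ∈ X → t ∈ Z → InAllLeaves t n
    spanning {t} t∈I X∈ t∈X t∈Z with ∈-leaves⇒at n X∈
    ... | s , X-at with fork-span r i≢j (subst (λ p → 𝒯 at p ≔ _) (++-assoc r (i ∷ rᵢ) s) (at-++⁺ at-n X-at))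
                          at-Z t∈I t∈X t∈Z at-y
    ... | P-case , Q-case = spread y refl e
      where
      spread : ∀ y′ → y′ ≡ y → children y′ ‼ i ≡ just _ → InAllLeaves t n
      spread (pnode cs) refl e = All.tabulate λ W∈ → All.lookup (P-case cs refl) (∈-leaves-at {s = pnode cs} (there i e n-at) W∈)
      spread (qnode cs) refl e =
        All.tabulate λ W∈ → All.lookup (Q-case cs refl i _ (m⊓n≤m i j) (m≤m⊔n i j) e) (∈-leaves-at n-at W∈)

  maxClique∈leaves-𝒯 : MaxCliqueOfInduced G I X → X ∈ˡ leaves 𝒯
  maxClique∈leaves-𝒯 (cliqueX , maximal) with clique⊆leaf-𝒯 cliqueX
  ... | Z , Z∈ , X⊆Z with ⊆-antisym X⊆Z (maximal Z (leaf-𝒯⇒clique Z∈) X⊆Z)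
  ... | refl = Z∈

  maxClique-leaf-unique : MaxCliqueOfInduced G I X → 𝒯 at p ≔ leaf X → 𝒯 at q ≔ leaf X → p ≡ q
  maxClique-leaf-unique {p = p} {q = q} maxX at-p at-q with compare p q
  ... | equal e = e
  ... | below i r refl with at-++⁻ p at-q
  ...   | y , at-y , X-at with at-functional at-y at-p
  ...     | refl = ⊥-elim (leaf-at-∷ X-at)
  maxClique-leaf-unique {q = q} maxX at-p at-q | above i r refl with at-++⁻ q at-p
  ...   | y , at-y , X-at with at-functional at-y at-q
  ...     | refl = ⊥-elim (leaf-at-∷ X-at)
  maxClique-leaf-unique {X = X} maxX at-p at-q | fork r i j rᵢ rⱼ i≢j refl refl with at-++⁻ r at-p
  ... | y , at-y , _ = ⊥-elim (no-lca y refl)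
    where
    spanned : ∀ {t} → t ∈ X → Spanned t y i j
    spanned t∈X = fork-span r i≢j at-p at-q (leaf-𝒯⊆I (∈-leaves-at at-p (here refl)) t∈X) t∈X t∈X at-y

    no-lca : ∀ y′ → y′ ≡ y → ⊥
    no-lca (leaf _)   refl with at-++-∷⁻ r at-p at-y
    ... | _ , () , _
    no-lca (pnode cs) refl =
      nonUniform at-y (superset-leaves⇒uniform at-y maxX λ W∈ t∈X → All.lookup (proj₁ (spanned t∈X) cs refl) W∈)
    no-lca (qnode cs) refl with at-++-∷⁻ r at-p at-y | at-++-∷⁻ r at-q at-y
    ... | _ , eᵢ , _ | _ , eⱼ , _ with ‼-adjacent cs i≢j eᵢ eⱼ
    ...   | k , lo , hi , c , d , e₁ , e₂ =
      Linked-‼ k (apartNeighbours at-y) e₁ e₂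
        (uniform-child k c lo (≤-trans (n≤1+n k) hi) e₁) (uniform-child (suc k) d (≤-trans lo (n≤1+n k)) hi e₂)
      where
      uniform-child : ∀ k c → i ⊓ j ≤ k → k ≤ i ⊔ j → cs ‼ k ≡ just c → Uniform c X
      uniform-child k c lo hi e =
        superset-leaves⇒uniform (at-child at-y e) maxX λ W∈ t∈X → All.lookup (proj₂ (spanned t∈X) cs refl k c lo hi e) W∈

  -- A largest leaf below n is a maximal clique of G[I]: a larger clique would
  -- be covered by a leaf outside n, which would make n uniform.
  largest-leaf-maximal : 𝒯 at p ≔ n → (∀ X → n ≢ leaf X) → X ∈ˡ leaves n →
    (∀ {W} → W ∈ˡ leaves n → ∣ W ∣ ≤ ∣ X ∣) → MaxCliqueOfInduced G I X
  largest-leaf-maximal {n = n} {X = X} at-n nonLeaf X∈ largest-X = leaf-𝒯⇒clique X∈𝒯 , maximal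
    where
    X∈𝒯 : X ∈ˡ leaves 𝒯
    X∈𝒯 = ∈-leaves-at at-n X∈
    maximal : ∀ Y → IsClique (V G ∩ I) (Adj G) Y → X ⊆ Y → Y ⊆ X
    maximal Y cliqueY X⊆Y with clique⊆leaf-𝒯 cliqueY
    ... | Z , Z∈ , Y⊆Z with below-or-spanning at-n Z∈
    ...   | inj₁ Z∈n = λ m → ⊆∧∣≥∣⇒⊇ (λ m → Y⊆Z (X⊆Y m)) (largest-X Z∈n) (Y⊆Z m)
    ...   | inj₂ spanning = ⊥-elim (nonLeaf⇒nonUniform at-n nonLeaf (uniformly X∈ all-X))
      where
      all-X : ∀ {W} → W ∈ˡ leaves n → W ≡ X
      all-X {W} W∈ = sym (⊆-antisym X⊆W (⊆∧∣≥∣⇒⊇ X⊆W (largest-X W∈)))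
        where
        X⊆W : X ⊆ W
        X⊆W t∈X = All.lookup (spanning (leaf-𝒯⊆I X∈𝒯 t∈X) X∈ t∈X (Y⊆Z (X⊆Y t∈X))) W∈

  maxClique-below : 𝒯 at p ≔ n → (∀ X → n ≢ leaf X) → ∃₂ λ s X → n at s ≔ leaf X × MaxCliqueOfInduced G I X
  maxClique-below {n = n} at-n nonLeaf =
    let _ , W∈ = hasLeaf at-n
        X , X∈ , largest-X = largest (leaves n) W∈
        s , X-at = ∈-leaves⇒at n X∈
    in s , X , X-at , largest-leaf-maximal at-n nonLeaf X∈ largest-X

  children-span : 𝒯 at p ≔ n → i ≢ j → children n ‼ i ≡ just c₁ → children n ‼ j ≡ just c₂ →
    u ∈ U c₁ → u ∈ U c₂ → Spanned u n i j
  children-span {p = p} {n = n} at-n i≢j e₁ e₂ u∈₁ u∈₂ =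
    let X₁ , X₁∈ = hasLeaf (at-child at-n e₁)
        X₂ , X₂∈ = hasLeaf (at-child at-n e₂)
        r₁ , X₁-at = ∈-leaves⇒at _ X₁∈
        r₂ , X₂-at = ∈-leaves⇒at _ X₂∈
        u∈X₁ = All.lookup (∈-⋂⁻ _ u∈₁) X₁∈
        u∈I = leaf-𝒯⊆I (∈-leaves-at at-n (∈-leaves-child {s = n} e₁ X₁∈)) u∈X₁
    in fork-span p i≢j (at-++⁺ at-n (there _ e₁ X₁-at)) (at-++⁺ at-n (there _ e₂ X₂-at))
         u∈I u∈X₁ (All.lookup (∈-⋂⁻ _ u∈₂) X₂∈) at-n

  U-pnode : ∀ {cs} → 𝒯 at p ≔ pnode cs → i ≢ j → cs ‼ i ≡ just c₁ → cs ‼ j ≡ just c₂ →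
    U (pnode cs) ≡ U c₁ ∩ U c₂
  U-pnode {c₁ = c₁} {c₂ = c₂} {cs = cs} at-n i≢j e₁ e₂ = ⊆-antisym to from
    where
    to : U (pnode cs) ⊆ U c₁ ∩ U c₂
    to u∈ = x∈p∩q⁺ (U-child {n = pnode cs} e₁ u∈ , U-child {n = pnode cs} e₂ u∈)
    from : U c₁ ∩ U c₂ ⊆ U (pnode cs)
    from u∈ with x∈p∩q⁻ _ _ u∈
    ... | u∈₁ , u∈₂ = ∈-⋂⁺ (proj₁ (children-span at-n i≢j e₁ e₂ u∈₁ u∈₂) cs refl)

  U-qnode : ∀ {mid} → 𝒯 at p ≔ qnode (c₁ ∷ mid ++ [ c₂ ]) → U (qnode (c₁ ∷ mid ++ [ c₂ ])) ≡ U c₁ ∩ U c₂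
  U-qnode {c₁ = c₁} {c₂ = c₂} {mid = mid} at-n = ⊆-antisym to from
    where
    cs : List Tree
    cs = c₁ ∷ mid ++ [ c₂ ]
    last : cs ‼ suc (length mid) ≡ just c₂
    last = ‼-last mid c₂
    bound : ∀ k {c} → cs ‼ k ≡ just c → k ≤ suc (length mid)
    bound zero    _ = z≤n
    bound (suc k) e = s≤s (‼-≤-last mid e)
    to : U (qnode cs) ⊆ U c₁ ∩ U c₂
    to u∈ = x∈p∩q⁺ (U-child {n = qnode cs} {i = 0} refl u∈ , U-child {n = qnode cs} {i = suc (length mid)} last u∈)
    from : U c₁ ∩ U c₂ ⊆ U (qnode cs)
    from u∈ with x∈p∩q⁻ _ _ u∈
    ... | u∈₁ , u∈₂ = U-children {n = qnode cs} (λ _ ()) λ k c e →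
      ∈-⋂⁺ (proj₂ (children-span {i = 0} {j = suc (length mid)} at-n (λ ()) refl last u∈₁ u∈₂) cs refl k c z≤n (bound k e) e)

  nonMaximal⇒larger-leaf : X ∈ˡ leaves 𝒯 → ¬ MaxCliqueOfInduced G I X →
    ∃ λ Z → Z ∈ˡ leaves 𝒯 × X ⊆ Z × Z ≢ X
  nonMaximal⇒larger-leaf {X = X} X∈ nonMax with Any.any? (λ Z → (X ⊆? Z) ×-dec ¬? (Z ≟ X)) (leaves 𝒯)
  ... | yes larger = find larger
  ... | no none    = ⊥-elim (nonMax (leaf-𝒯⇒clique X∈ , maximal))
    where
    maximal : ∀ Y → IsClique (V G ∩ I) (Adj G) Y → X ⊆ Y → Y ⊆ X
    maximal Y cliqueY X⊆Y with clique⊆leaf-𝒯 cliqueY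
    ... | Z , Z∈ , Y⊆Z with Z ≟ X
    ...   | yes refl = Y⊆Z
    ...   | no Z≢X   = ⊥-elim (none (lose Z∈ ((λ m → Y⊆Z (X⊆Y m)) , Z≢X)))

  subclique-child-U : ∀ {cs} → 𝒯 at p ≔ pnode cs → cs ‼ i ≡ just (leaf X) → ¬ MaxCliqueOfInduced G I X →
    X ≡ U (pnode cs)
  subclique-child-U {p = p} {i = i} {X = X} {cs = cs} at-n e nonMax =
    ⊆-antisym X⊆U (λ u∈ → All.head (∈-⋂⁻ [ X ] (U-child {n = pnode cs} e u∈)))
    where
    X∈n : X ∈ˡ leaves (pnode cs)
    X∈n = ∈-leaves-child {s = pnode cs} e (here refl)

    X⊆U : X ⊆ U (pnode cs)
    X⊆U {t} t∈X with nonMaximal⇒larger-leaf (∈-leaves-at at-n X∈n) nonMax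
    ... | Z , Z∈ , X⊆Z , Z≢X with below-or-spanning at-n Z∈
    ...   | inj₂ spanning = ∈-⋂⁺ (spanning t∈I X∈n t∈X (X⊆Z t∈X))
      where t∈I = leaf-𝒯⊆I (∈-leaves-at at-n X∈n) t∈X
    ...   | inj₁ Z∈n with ∈-leaves⇒at (pnode cs) Z∈n
    ...     | j ∷ s , there _ e′ Z-at with j ≟ℕ i
    ...       | no j≢i = ∈-⋂⁺ (proj₁ (fork-span p (λ i≡j → j≢i (sym i≡j)) (at-child at-n e) (at-++⁺ at-n (there j e′ Z-at))
                                       (leaf-𝒯⊆I (∈-leaves-at at-n X∈n) t∈X) t∈X (X⊆Z t∈X) at-n) cs refl)
    ...       | yes refl with trans (sym e) e′
    ...         | refl with Z-at
    ...           | here = ⊥-elim (Z≢X refl)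
    ...           | there _ () _

lemma6 : ∀ {N : ℕ} (G₁ G₂ : Graph N) → IsInterval G₁ → IsInterval G₂ →
    SameOn G₁ G₂ (V G₁ ∩ V G₂) →
    ∀ (G : Graph N) → (G ≡ G₁ ⊎ G ≡ G₂) →
    ∀ (T : PQ (Subset N)) → IsPQTreeOf G T →
    let I = V G₁ ∩ V G₂
        𝒯 = IReduced I T
    in
    (∀ (q : Path) (i₁ i₂ : ℕ) (r₁ r₂ : Path) (X₁ X₂ : Subset N) t →
       i₁ ≢ i₂ →
       𝒯 at (q ++ i₁ ∷ r₁) ≔ leaf X₁ → 𝒯 at (q ++ i₂ ∷ r₂) ≔ leaf X₂ →
       t ∈ I → t ∈ X₁ → t ∈ X₂ →
       ∀ y → 𝒯 at q ≔ y →
         (∀ cs → y ≡ pnode cs → All (t ∈_) (leaves y)) ×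
         (∀ cs → y ≡ qnode cs → ∀ k c → i₁ ⊓ i₂ ≤ k → k ≤ i₁ ⊔ i₂ →
            cs ‼ k ≡ just c → All (t ∈_) (leaves c))) ×
    (∀ X → MaxCliqueOfInduced G I X →
       Σ Path λ p → 𝒯 at p ≔ leaf X × (∀ p′ → 𝒯 at p′ ≔ leaf X → p′ ≡ p)) ×
    (∀ p n → 𝒯 at p ≔ n → (∀ X → n ≢ leaf X) →
       (∀ u → (u ∈ U n ⇔ (∀ i c → children n ‼ i ≡ just c → u ∈ U c))) ×
       (Σ Path λ p′ → Σ (Subset N) λ X → n at p′ ≔ leaf X × MaxCliqueOfInduced G I X) ×
       (∀ cs → n ≡ pnode cs → ∀ i₁ i₂ c₁ c₂ → i₁ ≢ i₂ →
          cs ‼ i₁ ≡ just c₁ → cs ‼ i₂ ≡ just c₂ → U n ≡ U c₁ ∩ U c₂) ×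
       (∀ cs → n ≡ pnode cs → ∀ i X → cs ‼ i ≡ just (leaf X) →
          ¬ MaxCliqueOfInduced G I X → X ≡ U n) ×
       (∀ cs → n ≡ qnode cs → ∀ c₁ mid c₂ → cs ≡ c₁ ∷ mid ++ c₂ ∷ [] →
          U n ≡ U c₁ ∩ U c₂))
lemma6 G₁ G₂ _ _ _ G _ T isPQ =
  (λ q _ _ _ _ _ _ _ i₁≢i₂ at₁ at₂ t∈I t∈X₁ t∈X₂ _ at-y →
     fork-span q i₁≢i₂ at₁ at₂ t∈I t∈X₁ t∈X₂ at-y) ,
  (λ X maxX → let p , at-p = ∈-leaves⇒at 𝒯 (maxClique∈leaves-𝒯 maxX) in
              p , at-p , λ _ at-p′ → maxClique-leaf-unique maxX at-p′ at-p) ,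
  λ p n at-n nonLeaf →
    (λ u → mk⇔ (λ u∈ _ _ e → U-child {n = n} e u∈) (U-children nonLeaf)) ,
    maxClique-below at-n nonLeaf ,
    (λ { _ refl _ _ _ _ i₁≢i₂ e₁ e₂ → U-pnode at-n i₁≢i₂ e₁ e₂ }) ,
    (λ { _ refl _ _ e nonMax → subclique-child-U at-n e nonMax }) ,
    (λ { _ refl _ _ _ refl → U-qnode at-n })
  where open ReducedTree G (V G₁ ∩ V G₂) T isPQ
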